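{- If two finite posets $P$ and $Q$ satisfy $U_P=U_Q$, then $P$ and $Q$ have the same number of unordered triples of pairwise incomparable elements.
   Context: For a poset $P$, $D_P$ is the digraph on $P$ with edge $(i,j)$ iff $i<_Pj$, and $U_P=U_{D_P}$, where for a digraph $X=(V,E)$, $U_X=\sum_\sigma F_{X\mathrm{Des}(\sigma)}$, the sum over all listings $\sigma=(\sigma_1,\ldots,\sigma_n)$ of $V$, with $X\mathrm{Des}(\sigma)=\{i\in[n-1]:(\sigma_i,\sigma_{i+1})\in E\}$ and $F_I=\sum x_{i_1}\cdots x_{i_n}$ over $1\le i_1\le\cdots\le i_n$ with $i_j<i_{j+1}$ for $j\in I$ (Redei-Berge symmetric function). -}

module Defs where

open import Data.Nat using (ℕ; zero; suc; _<ᵇ_) renaming (_≤_ to _≤ℕ_)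
open import Data.Nat.Properties using () renaming (_≟_ to _≟ℕ_)
open import Data.Nat.ListAction using (sum)
open import Data.Bool.ListAction using (all; any)
open import Data.Bool using (Bool; true; false; if_then_else_; _∧_; not)
open import Data.Fin using (Fin; _<?_)
open import Data.Fin.Properties using (_≟_)
open import Data.List using (List; []; _∷_; _++_; map; concatMap; length; allFin)
open import Data.List.Relation.Unary.Linked using (Linked)
open import Data.Product using (_×_; _,_)
open import Relation.Binary.PropositionalEquality using (_≡_)
open import Relation.Binary.Structures using (IsDecPartialOrder)
open import Relation.Nullary using (¬_)
open import Relation.Nullary.Decidable using (⌊_⌋; _×-dec_; ¬?)

-- Finite posets: carrier Fin n (every finite poset is isomorphic to one)

record FinPoset : Set₁ where
  field
    size  : ℕ
    _≤P_  : Fin size → Fin size → Set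
    isDPO : IsDecPartialOrder _≡_ _≤P_

  open IsDecPartialOrder isDPO public using () renaming (_≤?_ to _≤P?_)

  ltᵇ : Fin size → Fin size → Bool
  ltᵇ i j = ⌊ (i ≤P? j) ×-dec ¬? (i ≟ j) ⌋

  incompᵇ : Fin size → Fin size → Bool
  incompᵇ i j = ⌊ ¬? (i ≤P? j) ×-dec ¬? (j ≤P? i) ⌋

open FinPoset public

Digraph : ℕ → Set
Digraph n = Fin n → Fin n → Bool

D : (P : FinPoset) → Digraph (size P)
D P = ltᵇ P

allLists : (n k : ℕ) → List (List (Fin n))
allLists n zero    = [] ∷ []
allLists n (suc k) = concatMap (λ v → map (_∷ v) (allFin n)) (allLists n k)

-- a length-n list over Fin n is a listing iff every vertex occurs in it
isListing : {n : ℕ} → List (Fin n) → Bool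
isListing {n} σ = all (λ x → any (λ y → ⌊ x ≟ y ⌋) σ) (allFin n)

-- X-descent set (1-indexed positions i with (σ_i , σ_{i+1}) ∈ E)
XDesFrom : {n : ℕ} → Digraph n → List (Fin n) → ℕ → List ℕ
XDesFrom X (a ∷ b ∷ r) k = (if X a b then k ∷ [] else []) ++ XDesFrom X (b ∷ r) (suc k)
XDesFrom X _           k = []

XDes : {n : ℕ} → Digraph n → List (Fin n) → List ℕ
XDes X σ = XDesFrom X σ 1

-- Formal power series in x_1, x_2, … with ℕ-coefficients.
-- A monomial x_{w_1} ⋯ x_{w_m} is represented by the weakly increasing
-- list w = (w_1 ≤ … ≤ w_m); a series is its coefficient function.

Series : Set
Series = List ℕ → ℕ

Monomial : List ℕ → Set
Monomial w = Linked _≤ℕ_ w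

_≈S_ : Series → Series → Set
f ≈S g = ∀ w → Monomial w → f w ≡ g w

-- 1-indexed lookup with default 0
nth : List ℕ → ℕ → ℕ
nth []       _             = 0
nth (x ∷ xs) zero          = 0
nth (x ∷ xs) (suc zero)    = x
nth (x ∷ xs) (suc (suc k)) = nth xs (suc k)

-- Fundamental quasisymmetric function F_I of degree n:
-- F_I = Σ x_{i_1}⋯x_{i_n} over i_1 ≤ ⋯ ≤ i_n with i_j < i_{j+1} for j ∈ I.
F : (n : ℕ) → List ℕ → Series
F n I w = if ⌊ length w ≟ℕ n ⌋ ∧ all (λ j → nth w j <ᵇ nth w (suc j)) I then 1 else 0

U : {n : ℕ} → Digraph n → Series
U {n} X w = sum (map (λ σ → if isListing σ then F n (XDes X σ) w else 0) (allLists n n))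

U-poset : FinPoset → Series
U-poset P = U (D P)

-- number of unordered triples {a,b,c} of pairwise incomparable elements
-- (counted as a < b < c in the order of Fin)

incompTriples : FinPoset → ℕ
incompTriples P =
  sum (concatMap (λ a → concatMap (λ b → map (λ c →
    if ⌊ a <? b ⌋ ∧ ⌊ b <? c ⌋ ∧ incompᵇ P a b ∧ incompᵇ P a c ∧ incompᵇ P b c
    then 1 else 0)
      (allFin (size P))) (allFin (size P))) (allFin (size P)))

module Submission where

-- Write A₁, A₂, A₃ for the numbers of ordered tuples of distinct elements (a, b), (a, b, c) and
-- (a, b, c, d) of P with a ≮ b, with a ≮ b ≮ c, and with a ≮ b and c ≮ d. In U_P the coefficients of
-- x₁ ⋯ xₙ, x₁² x₂ ⋯ xₙ₋₁, x₁³ x₂ ⋯ xₙ₋₂ and x₁² x₂² x₃ ⋯ xₙ₋₂ are n!, (n-2)! A₁, (n-3)! A₂ and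
-- (n-4)! A₃: a listing contributes exactly when it has no descent where the monomial repeats an index,
-- and a listing of its first k entries extends to (n-k)! listings. So U_P determines n, A₁, A₂, A₃.
-- Expanding A₁² by how the two pairs meet, and comparing, on each 3-element subposet summed over its
-- six orderings, the counts of antichains, incomparable pairs, non-arc paths and overlapping
-- non-arc pairs, expresses 6 · #{incomparable triples} as a function of n, A₁, A₂, A₃.

open import Algebra.Properties.CommutativeSemigroup using (x∙yz≈y∙xz)
open import Data.Bool using (Bool; true; false; if_then_else_; _∧_; _∨_; not)
open import Data.Bool.ListAction using (all; any)
open import Data.Bool.Properties
  using (T-≡; ∨-assoc; ∨-comm; ∨-identityʳ; ∨-zeroʳ; ∧-identityʳ; ∧-assoc; ⇔→≡)
  renaming (_≟_ to _≟ᵇ_)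
open import Data.Empty using (⊥-elim)
open import Data.Fin using (Fin; zero; suc)
open import Data.Fin.Properties
  using (_≟_; _<?_; <-cmp; <⇒≢) renaming (<-asym to <-asymᶠ; <-trans to <-transᶠ)
open import Data.List using (List; []; _∷_; _++_; map; concatMap; length; allFin; tabulate)
open import Data.List.Properties
  using (map-cong; map-tabulate; map-concatMap; map-∘; length-++; ++-identityʳ)
open import Data.List.Relation.Binary.Permutation.Propositional as ↭ using (_↭_)
open import Data.List.Relation.Binary.Permutation.Propositional.Properties using (shift)
open import Data.List.Relation.Unary.Linked using ([]; [-]; _∷_)
open import Data.Nat using (ℕ; zero; suc; _+_; _*_; _∸_; _≤_; _<_; z≤n; s≤s; _<ᵇ_; _!)
open import Data.Nat.Combinatorics.Base using (_P′_)
open import Data.Nat.Combinatorics.Specification using (nP′n≡n!)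
open import Data.Nat.ListAction using () renaming (sum to sumˡ)
open import Data.Nat.ListAction.Properties using (sum-++)
open import Data.Nat.Properties
  using (+-comm; *-comm; +-identityʳ; *-identityʳ; *-zeroʳ; *-distribˡ-+; *-cancelˡ-≡; suc-injective;
         ≤-refl; ≤-reflexive; ≤-trans; <-irrefl; +-mono-≤; n≤1+n; ≰⇒>; module ≤-Reasoning;
         m+n∸n≡m; m+n∸m≡n; m+[n∸m]≡n; ∸-+-assoc; 1≤n!; _!≢0; +-*-semiring; *-commutativeSemigroup)
open import Data.Nat.Solver using (module +-*-Solver)
open import Data.Product using (_×_; _,_; proj₁; proj₂)
open import Function using (_∘_; id)
open import Function.Bundles using (mk⇔; Equivalence)
open import Relation.Binary.Definitions using (tri<; tri≈; tri>)
open import Relation.Binary.PropositionalEquality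
open import Relation.Binary.Structures using (IsDecPartialOrder)
open import Relation.Nullary using (¬_)
open import Relation.Nullary.Decidable
  using (Dec; yes; no; ⌊_⌋; isYes≗does; dec-true; dec-false; toWitness; fromWitness; from-yes; _→-dec_)

open import Algebra.Properties.Semiring.Sum +-*-semiring
  using (sum; sum-syntax; sum-cong-≗; ∑-distrib-+; ∑-comm; sum-replicate-zero; *-distribˡ-sum; *-distribʳ-sum)
open import Defs
  using (FinPoset; size; _≤P_; _≤P?_; isDPO; ltᵇ; incompᵇ; incompTriples; D; U-poset;
         Digraph; allLists; isListing; XDesFrom; XDes; nth; F; U; Monomial; _≈S_)

*-left-comm : ∀ x y z → x * (y * z) ≡ y * (x * z)
*-left-comm = x∙yz≈y∙xz *-commutativeSemigroup

χ : Bool → ℕ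
χ b = if b then 1 else 0

χ-∧ : ∀ a b → χ (a ∧ b) ≡ χ a * χ b
χ-∧ false b     = refl
χ-∧ true  false = refl
χ-∧ true  true  = refl

χ-idem : ∀ b → χ b * χ b ≡ χ b
χ-idem false = refl
χ-idem true  = refl

χ≤1 : ∀ b → χ b ≤ 1
χ≤1 false = z≤n
χ≤1 true  = s≤s z≤n

χ*-cong : ∀ b {x y} → (b ≡ true → x ≡ y) → χ b * x ≡ χ b * y
χ*-cong false _   = refl
χ*-cong true  x≡y = cong (_+ 0) (x≡y refl)

χ+χ-not : ∀ b → χ b + χ (not b) ≡ 1
χ+χ-not false = refl
χ+χ-not true  = refl

∧-true : ∀ {p q} → p ≡ true → q ≡ true → p ∧ q ≡ true
∧-true refl refl = refl

∀-Bool? : {P : Bool → Set} → (∀ b → Dec (P b)) → Dec (∀ b → P b)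
∀-Bool? P? with P? true | P? false
... | yes p | yes q = yes λ { true → p ; false → q }
... | no ¬p | _     = no λ h → ¬p (h true)
... | _     | no ¬q = no λ h → ¬q (h false)

Bool⁶ : Set → Set
Bool⁶ A = Bool → Bool → Bool → Bool → Bool → Bool → A

Identity⁶ : (C : Bool⁶ Bool) (L R : Bool⁶ ℕ) → Set
Identity⁶ C L R = ∀ a b c d e f → C a b c d e f ≡ true → L a b c d e f ≡ R a b c d e f

identity⁶? : ∀ C L R → Dec (Identity⁶ C L R)
identity⁶? C L R =
  ∀-Bool? λ a → ∀-Bool? λ b → ∀-Bool? λ c → ∀-Bool? λ d → ∀-Bool? λ e → ∀-Bool? λ f →
  (C a b c d e f ≟ᵇ true) →-dec (L a b c d e f Data.Nat.≟ R a b c d e f)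

sumˡ-tabulate : ∀ {n} (h : Fin n → ℕ) → sumˡ (tabulate h) ≡ sum h
sumˡ-tabulate {zero}  h = refl
sumˡ-tabulate {suc n} h = cong (h zero +_) (sumˡ-tabulate (h ∘ suc))

sumˡ-allFin : ∀ {n} (h : Fin n → ℕ) → sumˡ (map h (allFin n)) ≡ sum h
sumˡ-allFin {n} h = trans (cong sumˡ (map-tabulate id h)) (sumˡ-tabulate h)

sumˡ-concatMap : ∀ {A : Set} (g : A → List ℕ) (xs : List A) → sumˡ (concatMap g xs) ≡ sumˡ (map (sumˡ ∘ g) xs)
sumˡ-concatMap g []       = refl
sumˡ-concatMap g (x ∷ xs) = trans (sum-++ (g x) _) (cong (sumˡ (g x) +_) (sumˡ-concatMap g xs))

⌊⌋-true : ∀ {A : Set} (a? : Dec A) → A → ⌊ a? ⌋ ≡ true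
⌊⌋-true a? a = trans (isYes≗does a?) (dec-true a? a)

⌊⌋-false : ∀ {A : Set} (a? : Dec A) → ¬ A → ⌊ a? ⌋ ≡ false
⌊⌋-false a? ¬a = trans (isYes≗does a?) (dec-false a? ¬a)

⌊suc≟suc⌋ : ∀ {n} (c a : Fin n) → ⌊ suc c ≟ suc a ⌋ ≡ ⌊ c ≟ a ⌋
⌊suc≟suc⌋ c a = trans (isYes≗does (suc c ≟ suc a)) (sym (isYes≗does (c ≟ a)))

⌊≟⌋-sym : ∀ {n} (x y : Fin n) → ⌊ x ≟ y ⌋ ≡ ⌊ y ≟ x ⌋
⌊≟⌋-sym x y with x ≟ y | y ≟ x
... | yes _   | yes _   = refl
... | no  _   | no  _   = refl
... | yes x≡y | no  y≢x = ⊥-elim (y≢x (sym x≡y))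
... | no  x≢y | yes y≡x = ⊥-elim (x≢y (sym y≡x))

∑-δ : ∀ {n} (a : Fin n) (h : Fin n → ℕ) → ∑[ c < n ] (χ ⌊ c ≟ a ⌋ * h c) ≡ h a
∑-δ {suc n} zero    h = trans (cong₂ _+_ (+-identityʳ (h zero)) (sum-replicate-zero n)) (+-identityʳ _)
∑-δ {suc n} (suc a) h =
  trans (sum-cong-≗ {x = λ c → χ ⌊ suc c ≟ suc a ⌋ * h (suc c)} (λ c → cong (λ b → χ b * h (suc c)) (⌊suc≟suc⌋ c a)))
        (∑-δ a (h ∘ suc))

∑-const : ∀ n c → ∑[ i < n ] c ≡ n * c
∑-const zero    c = refl
∑-const (suc n) c = cong (c +_) (∑-const n c)

∑-indicator≤ : ∀ {n} (f : Fin n → Bool) → ∑[ i < n ] χ (f i) ≤ n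
∑-indicator≤ {zero}  f = z≤n
∑-indicator≤ {suc n} f = +-mono-≤ (χ≤1 (f zero)) (∑-indicator≤ (f ∘ suc))

all-tabulate⇒ : ∀ {A : Set} {m} (p : A → Bool) (g : Fin m → A) →
  all p (tabulate g) ≡ true → ∑[ i < m ] χ (p (g i)) ≡ m
all-tabulate⇒ {m = zero}  p g _ = refl
all-tabulate⇒ {m = suc m} p g all≡true with p (g zero)
... | true = cong suc (all-tabulate⇒ p (g ∘ suc) all≡true)

all-tabulate⇐ : ∀ {A : Set} {m} (p : A → Bool) (g : Fin m → A) →
  ∑[ i < m ] χ (p (g i)) ≡ m → all p (tabulate g) ≡ true
all-tabulate⇐ {m = zero}  p g _ = refl
all-tabulate⇐ {m = suc m} p g ∑≡m with p (g zero)
... | true  = all-tabulate⇐ p (g ∘ suc) (suc-injective ∑≡m)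
... | false = ⊥-elim (<-irrefl refl (≤-trans (≤-reflexive (sym ∑≡m)) (∑-indicator≤ (p ∘ g ∘ suc))))

module _ {n : ℕ} where

  ∑ᴸ : ℕ → (List (Fin n) → ℕ) → ℕ
  ∑ᴸ zero    f = f []
  ∑ᴸ (suc m) f = ∑ᴸ m (λ τ → ∑[ x < n ] f (x ∷ τ))

  sumˡ-allLists : ∀ m (f : List (Fin n) → ℕ) → sumˡ (map f (allLists n m)) ≡ ∑ᴸ m f
  sumˡ-allLists zero    f = +-identityʳ (f [])
  sumˡ-allLists (suc m) f = begin
    sumˡ (map f (concatMap (λ τ → map (_∷ τ) (allFin n)) (allLists n m)))
      ≡⟨ cong sumˡ (map-concatMap f _ (allLists n m)) ⟩
    sumˡ (concatMap (λ τ → map f (map (_∷ τ) (allFin n))) (allLists n m))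
      ≡⟨ sumˡ-concatMap _ (allLists n m) ⟩
    sumˡ (map (λ τ → sumˡ (map f (map (_∷ τ) (allFin n)))) (allLists n m))
      ≡⟨ cong sumˡ (map-cong (λ τ → trans (cong sumˡ (sym (map-∘ (allFin n)))) (sumˡ-allFin (f ∘ (_∷ τ)))) (allLists n m)) ⟩
    sumˡ (map (λ τ → ∑[ x < n ] f (x ∷ τ)) (allLists n m))
      ≡⟨ sumˡ-allLists m _ ⟩
    ∑ᴸ (suc m) f ∎
    where open ≡-Reasoning

  ∑ᴸ-cong : ∀ m {f g : List (Fin n) → ℕ} → (∀ σ → length σ ≡ m → f σ ≡ g σ) → ∑ᴸ m f ≡ ∑ᴸ m g
  ∑ᴸ-cong zero    f≡g = f≡g [] refl
  ∑ᴸ-cong (suc m) f≡g = ∑ᴸ-cong m (λ τ ∣τ∣ → sum-cong-≗ (λ x → f≡g (x ∷ τ) (cong suc ∣τ∣)))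

  ∑ᴸ-zero : ∀ m → ∑ᴸ m (λ _ → 0) ≡ 0
  ∑ᴸ-zero zero    = refl
  ∑ᴸ-zero (suc m) = trans (∑ᴸ-cong m (λ _ _ → sum-replicate-zero n)) (∑ᴸ-zero m)

  *-distribˡ-∑ᴸ : ∀ m c (f : List (Fin n) → ℕ) → c * ∑ᴸ m f ≡ ∑ᴸ m (λ σ → c * f σ)
  *-distribˡ-∑ᴸ zero    c f = refl
  *-distribˡ-∑ᴸ (suc m) c f = trans (*-distribˡ-∑ᴸ m c _) (∑ᴸ-cong m (λ τ _ → *-distribˡ-sum c (λ x → f (x ∷ τ))))

  ∑ᴸ-comm-∑ : ∀ m {k} (h : List (Fin n) → Fin k → ℕ) →
    ∑ᴸ m (λ σ → ∑[ y < k ] h σ y) ≡ ∑[ y < k ] ∑ᴸ m (λ σ → h σ y)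
  ∑ᴸ-comm-∑ zero    h = refl
  ∑ᴸ-comm-∑ (suc m) h = trans (∑ᴸ-cong m (λ τ _ → ∑-comm (λ x y → h (x ∷ τ) y))) (∑ᴸ-comm-∑ m (λ τ y → ∑[ x < n ] h (x ∷ τ) y))

  ∑ᴸ-comm : ∀ m k (h : List (Fin n) → List (Fin n) → ℕ) →
    ∑ᴸ m (λ τ → ∑ᴸ k (λ ρ → h ρ τ)) ≡ ∑ᴸ k (λ ρ → ∑ᴸ m (λ τ → h ρ τ))
  ∑ᴸ-comm m zero    h = refl
  ∑ᴸ-comm m (suc k) h = trans (∑ᴸ-comm m k _) (∑ᴸ-cong k (λ ρ _ → ∑ᴸ-comm-∑ m (λ τ x → h (x ∷ ρ) τ)))

  ∑ᴸ-++ : ∀ k m (f : List (Fin n) → ℕ) → ∑ᴸ (k + m) f ≡ ∑ᴸ m (λ τ → ∑ᴸ k (λ ρ → f (ρ ++ τ)))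
  ∑ᴸ-++ zero    m f = refl
  ∑ᴸ-++ (suc k) m f = ∑ᴸ-++ k m _

-- Lists without repetitions

module _ {n : ℕ} where

  mem : Fin n → List (Fin n) → Bool
  mem x = any (λ y → ⌊ x ≟ y ⌋)

  distinct : List (Fin n) → Bool
  distinct []      = true
  distinct (y ∷ σ) = not (mem y σ) ∧ distinct σ

  count : List (Fin n) → ℕ
  count σ = ∑[ x < n ] χ (mem x σ)

  count-∷ : ∀ y σ → count (y ∷ σ) ≡ count σ + χ (not (mem y σ))
  count-∷ y σ = begin
    ∑[ x < n ] χ (mem x (y ∷ σ))                                     ≡⟨ sum-cong-≗ split ⟩
    ∑[ x < n ] (χ (mem x σ) + χ ⌊ x ≟ y ⌋ * χ (not (mem y σ)))      ≡⟨ ∑-distrib-+ (λ x → χ (mem x σ)) _ ⟩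
    count σ + ∑[ x < n ] (χ ⌊ x ≟ y ⌋ * χ (not (mem y σ)))          ≡⟨ cong (count σ +_) (∑-δ y _) ⟩
    count σ + χ (not (mem y σ))                                      ∎
    where
    open ≡-Reasoning
    split : ∀ x → χ (mem x (y ∷ σ)) ≡ χ (mem x σ) + χ ⌊ x ≟ y ⌋ * χ (not (mem y σ))
    split x with x ≟ y
    ... | yes refl = sym (trans (cong (χ (mem x σ) +_) (+-identityʳ _)) (χ+χ-not (mem x σ)))
    ... | no  _    = sym (+-identityʳ _)

  count≤length : ∀ σ → count σ ≤ length σ
  count≤length []      = ≤-reflexive (sum-replicate-zero n)
  count≤length (y ∷ σ) = begin
    count (y ∷ σ)                ≡⟨ count-∷ y σ ⟩
    count σ + χ (not (mem y σ))  ≤⟨ +-mono-≤ (count≤length σ) (χ≤1 _) ⟩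
    length σ + 1                 ≡⟨ +-comm (length σ) 1 ⟩
    length (y ∷ σ)               ∎
    where open ≤-Reasoning

  distinct⇒count≡length : ∀ σ → distinct σ ≡ true → count σ ≡ length σ
  distinct⇒count≡length []      _ = sum-replicate-zero n
  distinct⇒count≡length (y ∷ σ) d with mem y σ | count-∷ y σ
  ... | false | count≡ =
    trans count≡ (trans (cong (_+ 1) (distinct⇒count≡length σ d)) (+-comm (length σ) 1))

  count≡length⇒distinct : ∀ σ → count σ ≡ length σ → distinct σ ≡ true
  count≡length⇒distinct []      _ = refl
  count≡length⇒distinct (y ∷ σ) c with mem y σ | count-∷ y σ
  ... | true  | count≡ = ⊥-elim (<-irrefl refl (begin-strict
    length σ          <⟨ s≤s ≤-refl ⟩
    length (y ∷ σ)    ≡⟨ sym c ⟩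
    count (y ∷ σ)     ≡⟨ trans count≡ (+-identityʳ _) ⟩
    count σ           ≤⟨ count≤length σ ⟩
    length σ          ∎))
    where open ≤-Reasoning
  ... | false | count≡ = count≡length⇒distinct σ (suc-injective (trans (trans (+-comm 1 (count σ)) (sym count≡)) c))

  distinct⇒length≤n : ∀ σ → distinct σ ≡ true → length σ ≤ n
  distinct⇒length≤n σ d = ≤-trans (≤-reflexive (sym (distinct⇒count≡length σ d))) (∑-indicator≤ (λ x → mem x σ))

  isListing≡distinct : ∀ σ → length σ ≡ n → isListing σ ≡ distinct σ
  isListing≡distinct σ ∣σ∣≡n = ⇔→≡ {z = true} (mk⇔
    (λ l → count≡length⇒distinct σ (trans (all-tabulate⇒ (λ x → mem x σ) id l) (sym ∣σ∣≡n)))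
    (λ d → all-tabulate⇐ (λ x → mem x σ) id (trans (distinct⇒count≡length σ d) ∣σ∣≡n)))

  mem-↭ : ∀ x {σ σ′} → σ ↭ σ′ → mem x σ ≡ mem x σ′
  mem-↭ x ↭.refl          = refl
  mem-↭ x (↭.prep y p)    = cong (⌊ x ≟ y ⌋ ∨_) (mem-↭ x p)
  mem-↭ x (↭.swap {σ} {σ′} y z p) = begin
    ⌊ x ≟ y ⌋ ∨ (⌊ x ≟ z ⌋ ∨ mem x σ)   ≡⟨ sym (∨-assoc ⌊ x ≟ y ⌋ _ _) ⟩
    (⌊ x ≟ y ⌋ ∨ ⌊ x ≟ z ⌋) ∨ mem x σ   ≡⟨ cong₂ _∨_ (∨-comm ⌊ x ≟ y ⌋ _) (mem-↭ x p) ⟩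
    (⌊ x ≟ z ⌋ ∨ ⌊ x ≟ y ⌋) ∨ mem x σ′  ≡⟨ ∨-assoc ⌊ x ≟ z ⌋ _ _ ⟩
    ⌊ x ≟ z ⌋ ∨ (⌊ x ≟ y ⌋ ∨ mem x σ′)  ∎
    where open ≡-Reasoning
  mem-↭ x (↭.trans p q)   = trans (mem-↭ x p) (mem-↭ x q)

  distinct-↭ : ∀ {σ σ′} → σ ↭ σ′ → distinct σ ≡ distinct σ′
  distinct-↭ ↭.refl         = refl
  distinct-↭ (↭.prep y p)   = cong₂ (λ m d → not m ∧ d) (mem-↭ y p) (distinct-↭ p)
  distinct-↭ (↭.swap {σ} {σ′} y z p)
    rewrite mem-↭ y p | mem-↭ z p | distinct-↭ p | ⌊≟⌋-sym y z =
      swap-fresh ⌊ z ≟ y ⌋ (mem y σ′) (mem z σ′) (distinct σ′)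
    where
    swap-fresh : ∀ e p q d → not (e ∨ p) ∧ (not q ∧ d) ≡ not (e ∨ q) ∧ (not p ∧ d)
    swap-fresh true  p     q     d = refl
    swap-fresh false false false d = refl
    swap-fresh false false true  d = refl
    swap-fresh false true  false d = refl
    swap-fresh false true  true  d = refl
  distinct-↭ (↭.trans p q)  = trans (distinct-↭ p) (distinct-↭ q)

  ∑-fresh : ∀ σ → ∑[ x < n ] χ (not (mem x σ)) ≡ n ∸ count σ
  ∑-fresh σ = sym (trans (cong (_∸ count σ) (sym fresh+count≡n)) (m+n∸n≡m _ (count σ)))
    where
    fresh+count≡n : ∑[ x < n ] χ (not (mem x σ)) + count σ ≡ n
    fresh+count≡n = begin
      ∑[ x < n ] χ (not (mem x σ)) + count σ           ≡⟨ sym (∑-distrib-+ (λ x → χ (not (mem x σ))) _) ⟩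
      ∑[ x < n ] (χ (not (mem x σ)) + χ (mem x σ))
        ≡⟨ sum-cong-≗ (λ x → trans (+-comm (χ (not (mem x σ))) (χ (mem x σ))) (χ+χ-not (mem x σ))) ⟩
      ∑[ x < n ] 1                                     ≡⟨ trans (∑-const n 1) (*-identityʳ n) ⟩
      n                                                ∎
      where open ≡-Reasoning

  ∑-distinct-∷ : ∀ σ → ∑[ x < n ] χ (distinct (x ∷ σ)) ≡ χ (distinct σ) * (n ∸ length σ)
  ∑-distinct-∷ σ = begin
    ∑[ x < n ] χ (distinct (x ∷ σ))
      ≡⟨ sum-cong-≗ (λ x → trans (χ-∧ (not (mem x σ)) (distinct σ)) (*-comm (χ (not (mem x σ))) (χ (distinct σ)))) ⟩
    ∑[ x < n ] (χ (distinct σ) * χ (not (mem x σ)))  ≡⟨ sym (*-distribˡ-sum (χ (distinct σ)) (λ x → χ (not (mem x σ)))) ⟩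
    χ (distinct σ) * ∑[ x < n ] χ (not (mem x σ))    ≡⟨ cong (χ (distinct σ) *_) (∑-fresh σ) ⟩
    χ (distinct σ) * (n ∸ count σ)                   ≡⟨ χ*-cong (distinct σ) (cong (n ∸_) ∘ distinct⇒count≡length σ) ⟩
    χ (distinct σ) * (n ∸ length σ)                  ∎
    where open ≡-Reasoning

  ∑ᴸ-distinct-extensions : ∀ m ρ → ∑ᴸ m (λ τ → χ (distinct (ρ ++ τ))) ≡ χ (distinct ρ) * ((n ∸ length ρ) P′ m)
  ∑ᴸ-distinct-extensions zero    ρ = trans (cong (χ ∘ distinct) (++-identityʳ ρ)) (sym (*-identityʳ _))
  ∑ᴸ-distinct-extensions (suc m) ρ = begin
    ∑ᴸ m (λ τ → ∑[ x < n ] χ (distinct (ρ ++ x ∷ τ)))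
      ≡⟨ ∑ᴸ-cong m (λ τ ∣τ∣ → trans (sum-cong-≗ (λ x → cong χ (distinct-↭ (shift x ρ τ)))) (extend τ ∣τ∣)) ⟩
    ∑ᴸ m (λ τ → r * χ (distinct (ρ ++ τ)))
      ≡⟨ sym (*-distribˡ-∑ᴸ m r _) ⟩
    r * ∑ᴸ m (λ τ → χ (distinct (ρ ++ τ)))
      ≡⟨ cong (r *_) (∑ᴸ-distinct-extensions m ρ) ⟩
    r * (χ (distinct ρ) * ((n ∸ length ρ) P′ m))
      ≡⟨ *-left-comm r (χ (distinct ρ)) ((n ∸ length ρ) P′ m) ⟩
    χ (distinct ρ) * (r * ((n ∸ length ρ) P′ m))
      ≡⟨ cong (λ r′ → χ (distinct ρ) * (r′ * ((n ∸ length ρ) P′ m))) (sym (∸-+-assoc n (length ρ) m)) ⟩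
    χ (distinct ρ) * ((n ∸ length ρ) P′ suc m) ∎
    where
    open ≡-Reasoning
    r : ℕ
    r = n ∸ (length ρ + m)
    extend : ∀ τ → length τ ≡ m → ∑[ x < n ] χ (distinct (x ∷ ρ ++ τ)) ≡ r * χ (distinct (ρ ++ τ))
    extend τ ∣τ∣ = trans (∑-distinct-∷ (ρ ++ τ)) (trans (*-comm (χ (distinct (ρ ++ τ))) _)
      (cong (λ l → (n ∸ l) * χ (distinct (ρ ++ τ))) (trans (length-++ ρ) (cong (length ρ +_) ∣τ∣))))

  ∑ᴸ-prefix : ∀ k m (f g : List (Fin n) → ℕ) →
    (∀ ρ τ → length ρ ≡ k → length τ ≡ m → f (ρ ++ τ) ≡ χ (distinct (ρ ++ τ)) * g ρ) →
    ∑ᴸ (k + m) f ≡ ((n ∸ k) P′ m) * ∑ᴸ k (λ ρ → χ (distinct ρ) * g ρ)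
  ∑ᴸ-prefix k m f g f≡ = begin
    ∑ᴸ (k + m) f
      ≡⟨ ∑ᴸ-++ k m f ⟩
    ∑ᴸ m (λ τ → ∑ᴸ k (λ ρ → f (ρ ++ τ)))
      ≡⟨ ∑ᴸ-cong m (λ τ ∣τ∣ → ∑ᴸ-cong k (λ ρ ∣ρ∣ → trans (f≡ ρ τ ∣ρ∣ ∣τ∣) (*-comm _ (g ρ)))) ⟩
    ∑ᴸ m (λ τ → ∑ᴸ k (λ ρ → g ρ * χ (distinct (ρ ++ τ))))
      ≡⟨ ∑ᴸ-comm m k _ ⟩
    ∑ᴸ k (λ ρ → ∑ᴸ m (λ τ → g ρ * χ (distinct (ρ ++ τ))))
      ≡⟨ ∑ᴸ-cong k extend ⟩
    ∑ᴸ k (λ ρ → ((n ∸ k) P′ m) * (χ (distinct ρ) * g ρ))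
      ≡⟨ sym (*-distribˡ-∑ᴸ k ((n ∸ k) P′ m) (λ ρ → χ (distinct ρ) * g ρ)) ⟩
    ((n ∸ k) P′ m) * ∑ᴸ k (λ ρ → χ (distinct ρ) * g ρ) ∎
    where
    open ≡-Reasoning
    extend : ∀ ρ → length ρ ≡ k → ∑ᴸ m (λ τ → g ρ * χ (distinct (ρ ++ τ))) ≡ ((n ∸ k) P′ m) * (χ (distinct ρ) * g ρ)
    extend ρ refl = begin
      ∑ᴸ m (λ τ → g ρ * χ (distinct (ρ ++ τ)))            ≡⟨ sym (*-distribˡ-∑ᴸ m (g ρ) _) ⟩
      g ρ * ∑ᴸ m (λ τ → χ (distinct (ρ ++ τ)))            ≡⟨ cong (g ρ *_) (∑ᴸ-distinct-extensions m ρ) ⟩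
      g ρ * (χ (distinct ρ) * ((n ∸ length ρ) P′ m))      ≡⟨ *-left-comm (g ρ) (χ (distinct ρ)) ((n ∸ length ρ) P′ m) ⟩
      χ (distinct ρ) * (g ρ * ((n ∸ length ρ) P′ m))      ≡⟨ cong (χ (distinct ρ) *_) (*-comm (g ρ) _) ⟩
      χ (distinct ρ) * (((n ∸ length ρ) P′ m) * g ρ)      ≡⟨ *-left-comm (χ (distinct ρ)) ((n ∸ length ρ) P′ m) (g ρ) ⟩
      ((n ∸ length ρ) P′ m) * (χ (distinct ρ) * g ρ)        ∎

  ∑ᴸ-distinct-pigeonhole : ∀ k (g : List (Fin n) → ℕ) → n < k → ∑ᴸ k (λ ρ → χ (distinct ρ) * g ρ) ≡ 0
  ∑ᴸ-distinct-pigeonhole k g n<k = trans (∑ᴸ-cong k vanish) (∑ᴸ-zero k)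
    where
    vanish : ∀ ρ → length ρ ≡ k → χ (distinct ρ) * g ρ ≡ 0
    vanish ρ refl = trans (χ*-cong (distinct ρ) (λ d → ⊥-elim (<-irrefl refl (≤-trans n<k (distinct⇒length≤n ρ d)))))
                            (*-zeroʳ (χ (distinct ρ)))

-- Coefficients of the Redei–Berge function

upFrom : ℕ → ℕ → List ℕ
upFrom s zero    = []
upFrom s (suc k) = s ∷ upFrom (suc s) k

length-upFrom : ∀ s k → length (upFrom s k) ≡ k
length-upFrom s zero    = refl
length-upFrom s (suc k) = cong suc (length-upFrom (suc s) k)

monomial-upFrom : ∀ s k → Monomial (upFrom s k)
monomial-upFrom s zero          = []
monomial-upFrom s (suc zero)    = [-]
monomial-upFrom s (suc (suc k)) = n≤1+n s ∷ monomial-upFrom (suc s) (suc k)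

monomial-∷-upFrom : ∀ {x} s k → x ≤ s → Monomial (x ∷ upFrom s k)
monomial-∷-upFrom s zero    _   = [-]
monomial-∷-upFrom s (suc k) x≤s = x≤s ∷ monomial-upFrom s (suc k)

<ᵇ-suc : ∀ s → (s <ᵇ suc s) ≡ true
<ᵇ-suc zero    = refl
<ᵇ-suc (suc s) = <ᵇ-suc s

all-++ : ∀ {A : Set} (p : A → Bool) xs ys → all p (xs ++ ys) ≡ all p xs ∧ all p ys
all-++ p []       ys = refl
all-++ p (x ∷ xs) ys = trans (cong (p x ∧_) (all-++ p xs ys)) (sym (∧-assoc (p x) _ _))

module _ {n : ℕ} (X : Digraph n) where

  strictAt : List ℕ → ℕ → Bool
  strictAt w j = nth w j <ᵇ nth w (suc j)

  -- the coefficient of F_(XDes σ) at the monomial w, provided length w ≡ n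
  fits : List ℕ → List (Fin n) → Bool
  fits w σ = all (strictAt w) (XDes X σ)

  private
    all-arc : ∀ (p : ℕ → Bool) k a b → all p (if X a b then k ∷ [] else []) ≡ (not (X a b) ∨ p k)
    all-arc p k a b with X a b
    ... | true  = ∧-identityʳ (p k)
    ... | false = refl

    all-shift : ∀ x ws σ k →
      all (strictAt (x ∷ ws)) (XDesFrom X σ (suc (suc k))) ≡ all (strictAt ws) (XDesFrom X σ (suc k))
    all-shift x ws []          k = refl
    all-shift x ws (a ∷ [])    k = refl
    all-shift x ws (a ∷ b ∷ σ) k = begin
      all (strictAt (x ∷ ws)) ((if X a b then 2 + k ∷ [] else []) ++ XDesFrom X (b ∷ σ) (3 + k))
        ≡⟨ all-++ (strictAt (x ∷ ws)) (if X a b then 2 + k ∷ [] else []) _ ⟩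
      all (strictAt (x ∷ ws)) (if X a b then 2 + k ∷ [] else []) ∧ all (strictAt (x ∷ ws)) (XDesFrom X (b ∷ σ) (3 + k))
        ≡⟨ cong₂ _∧_ (trans (all-arc _ _ a b) (sym (all-arc _ _ a b))) (all-shift x ws (b ∷ σ) (suc k)) ⟩
      all (strictAt ws) (if X a b then 1 + k ∷ [] else []) ∧ all (strictAt ws) (XDesFrom X (b ∷ σ) (2 + k))
        ≡⟨ sym (all-++ (strictAt ws) (if X a b then 1 + k ∷ [] else []) _) ⟩
      all (strictAt ws) ((if X a b then 1 + k ∷ [] else []) ++ XDesFrom X (b ∷ σ) (2 + k)) ∎
      where open ≡-Reasoning

  fits-∷∷ : ∀ x y ws a b σ → fits (x ∷ y ∷ ws) (a ∷ b ∷ σ) ≡ (not (X a b) ∨ (x <ᵇ y)) ∧ fits (y ∷ ws) (b ∷ σ)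
  fits-∷∷ x y ws a b σ = trans (all-++ (strictAt (x ∷ y ∷ ws)) (if X a b then 1 ∷ [] else []) _)
    (cong₂ _∧_ (all-arc _ 1 a b) (all-shift x (y ∷ ws) (b ∷ σ) 0))

  fits-upFrom : ∀ σ s k → length σ ≤ k → fits (upFrom s k) σ ≡ true
  fits-upFrom []          s k               _         = refl
  fits-upFrom (a ∷ [])    s k               _         = refl
  fits-upFrom (a ∷ b ∷ σ) s (suc (suc k)) (s≤s ∣σ∣≤k) = begin
    fits (upFrom s (2 + k)) (a ∷ b ∷ σ)                                    ≡⟨ fits-∷∷ s (suc s) _ a b σ ⟩
    (not (X a b) ∨ (s <ᵇ suc s)) ∧ fits (upFrom (suc s) (1 + k)) (b ∷ σ)
      ≡⟨ cong₂ _∧_ (trans (cong (not (X a b) ∨_) (<ᵇ-suc s)) (∨-zeroʳ _)) (fits-upFrom (b ∷ σ) (suc s) (suc k) ∣σ∣≤k) ⟩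
    true                                                                   ∎
    where open ≡-Reasoning

  U-coefficient : ∀ w k m → length w ≡ n → k + m ≡ n → (g : List (Fin n) → ℕ) →
    (∀ ρ τ → length ρ ≡ k → length τ ≡ m → χ (fits w (ρ ++ τ)) ≡ g ρ) →
    U X w ≡ m ! * ∑ᴸ k (λ ρ → χ (distinct ρ) * g ρ)
  U-coefficient w k m ∣w∣≡n k+m≡n g fits≡g = begin
    U X w                                               ≡⟨ sumˡ-allLists n term ⟩
    ∑ᴸ n term                                           ≡⟨ cong (λ l → ∑ᴸ l term) (sym k+m≡n) ⟩
    ∑ᴸ (k + m) term                                     ≡⟨ ∑ᴸ-prefix k m term g term≡ ⟩
    ((n ∸ k) P′ m) * ∑ᴸ k (λ ρ → χ (distinct ρ) * g ρ)  ≡⟨ cong (λ r → (r P′ m) * _) n∸k≡m ⟩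
    (m P′ m) * ∑ᴸ k (λ ρ → χ (distinct ρ) * g ρ)        ≡⟨ cong (_* _) (nP′n≡n! m) ⟩
    m ! * ∑ᴸ k (λ ρ → χ (distinct ρ) * g ρ)             ∎
    where
    open ≡-Reasoning
    term : List (Fin n) → ℕ
    term σ = if isListing σ then F n (XDes X σ) w else 0
    n∸k≡m : n ∸ k ≡ m
    n∸k≡m = trans (cong (_∸ k) (sym k+m≡n)) (m+n∸m≡n k m)
    term≡ : ∀ ρ τ → length ρ ≡ k → length τ ≡ m → term (ρ ++ τ) ≡ χ (distinct (ρ ++ τ)) * g ρ
    term≡ ρ τ ∣ρ∣ ∣τ∣
      rewrite isListing≡distinct (ρ ++ τ) (trans (length-++ ρ) (trans (cong₂ _+_ ∣ρ∣ ∣τ∣) k+m≡n))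
            | ⌊⌋-true (length w Data.Nat.≟ n) ∣w∣≡n
      with distinct (ρ ++ τ)
    ... | true  = trans (fits≡g ρ τ ∣ρ∣ ∣τ∣) (sym (+-identityʳ (g ρ)))
    ... | false = refl

  U-coefficient-length≢ : ∀ w → length w ≢ n → U X w ≡ 0
  U-coefficient-length≢ w ∣w∣≢n = trans (sumˡ-allLists n _) (trans (∑ᴸ-cong n (λ σ _ → vanish σ)) (∑ᴸ-zero n))
    where
    vanish : ∀ σ → (if isListing σ then F n (XDes X σ) w else 0) ≡ 0
    vanish σ with isListing σ
    ... | false = refl
    ... | true rewrite ⌊⌋-false (length w Data.Nat.≟ n) ∣w∣≢n = refl

  U-upFrom : U X (upFrom 1 n) ≡ n !
  U-upFrom = trans (U-coefficient (upFrom 1 n) 0 n (length-upFrom 1 n) refl (λ _ → 1) fits≡1) (*-identityʳ (n !))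
    where
    fits≡1 : ∀ ρ τ → length ρ ≡ 0 → length τ ≡ n → χ (fits (upFrom 1 n) (ρ ++ τ)) ≡ 1
    fits≡1 [] τ _ ∣τ∣ = cong χ (fits-upFrom τ 1 n (≤-reflexive ∣τ∣))

module _ {n : ℕ} where

  ∑₂ : (Fin n → Fin n → ℕ) → ℕ
  ∑₂ h = ∑[ b < n ] ∑[ a < n ] h a b

  ∑₃ : (Fin n → Fin n → Fin n → ℕ) → ℕ
  ∑₃ h = ∑[ c < n ] ∑[ b < n ] ∑[ a < n ] h a b c

  ∑₄ : (Fin n → Fin n → Fin n → Fin n → ℕ) → ℕ
  ∑₄ h = ∑[ d < n ] ∑[ c < n ] ∑[ b < n ] ∑[ a < n ] h a b c d

  ∑₂-cong : ∀ {h k : Fin n → Fin n → ℕ} → (∀ x y → h x y ≡ k x y) → ∑₂ h ≡ ∑₂ k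
  ∑₂-cong h≡k = sum-cong-≗ λ y → sum-cong-≗ λ x → h≡k x y

  ∑₃-cong : ∀ {h k : Fin n → Fin n → Fin n → ℕ} → (∀ x y z → h x y z ≡ k x y z) → ∑₃ h ≡ ∑₃ k
  ∑₃-cong h≡k = sum-cong-≗ λ z → ∑₂-cong λ x y → h≡k x y z

  distinct₂ : Fin n → Fin n → Bool
  distinct₂ a b = distinct (a ∷ b ∷ [])

  distinct₃ : Fin n → Fin n → Fin n → Bool
  distinct₃ a b c = distinct (a ∷ b ∷ c ∷ [])

  distinct₄ : Fin n → Fin n → Fin n → Fin n → Bool
  distinct₄ a b c d = distinct (a ∷ b ∷ c ∷ d ∷ [])

  onPairs : (Fin n → Fin n → ℕ) → List (Fin n) → ℕ
  onPairs h (a ∷ b ∷ _) = h a b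
  onPairs h _           = 0

  onTriples : (Fin n → Fin n → Fin n → ℕ) → List (Fin n) → ℕ
  onTriples h (a ∷ b ∷ c ∷ _) = h a b c
  onTriples h _               = 0

  onQuadruples : (Fin n → Fin n → Fin n → Fin n → ℕ) → List (Fin n) → ℕ
  onQuadruples h (a ∷ b ∷ c ∷ d ∷ _) = h a b c d
  onQuadruples h _                   = 0

module _ {n : ℕ} (X : Digraph n) where

  nonArc : Fin n → Fin n → ℕ
  nonArc a b = χ (not (X a b))

  nonArcs : ℕ
  nonArcs = ∑₂ λ a b → χ (distinct₂ a b) * nonArc a b

  nonArcPaths : ℕ
  nonArcPaths = ∑₃ λ a b c → χ (distinct₃ a b c) * (nonArc a b * nonArc b c)

  nonArcPairs : ℕ
  nonArcPairs = ∑₄ λ a b c d → χ (distinct₄ a b c d) * (nonArc a b * nonArc c d)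

monomial₂ monomial₃ monomial₂₂ : ℕ → List ℕ
monomial₂  m = 1 ∷ 1 ∷ upFrom 2 m
monomial₃  m = 1 ∷ 1 ∷ 1 ∷ upFrom 2 m
monomial₂₂ m = 1 ∷ 1 ∷ 2 ∷ 2 ∷ upFrom 3 m

module _ {n : ℕ} (X : Digraph n) (m : ℕ) where

  U-monomial₂ : 2 + m ≡ n → U X (monomial₂ m) ≡ m ! * nonArcs X
  U-monomial₂ 2+m≡n =
    U-coefficient X (monomial₂ m) 2 m (trans (cong (2 +_) (length-upFrom 2 m)) 2+m≡n) 2+m≡n (onPairs (nonArc X)) fits≡
    where
    fits≡ : ∀ ρ τ → length ρ ≡ 2 → length τ ≡ m → χ (fits X (monomial₂ m) (ρ ++ τ)) ≡ onPairs (nonArc X) ρ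
    fits≡ (a ∷ b ∷ []) τ _ ∣τ∣ = cong χ (begin
      fits X (monomial₂ m) (a ∷ b ∷ τ)                        ≡⟨ fits-∷∷ X 1 1 _ a b τ ⟩
      (not (X a b) ∨ false) ∧ fits X (upFrom 1 (suc m)) (b ∷ τ)
        ≡⟨ cong₂ _∧_ (∨-identityʳ _) (fits-upFrom X (b ∷ τ) 1 (suc m) (≤-reflexive (cong suc ∣τ∣))) ⟩
      not (X a b) ∧ true                                      ≡⟨ ∧-identityʳ _ ⟩
      not (X a b)                                             ∎)
      where open ≡-Reasoning

  U-monomial₃ : 3 + m ≡ n → U X (monomial₃ m) ≡ m ! * nonArcPaths X
  U-monomial₃ 3+m≡n =
    U-coefficient X (monomial₃ m) 3 m (trans (cong (3 +_) (length-upFrom 2 m)) 3+m≡n) 3+m≡n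
      (onTriples λ a b c → nonArc X a b * nonArc X b c) fits≡
    where
    fits≡ : ∀ ρ τ → length ρ ≡ 3 → length τ ≡ m →
      χ (fits X (monomial₃ m) (ρ ++ τ)) ≡ onTriples (λ a b c → nonArc X a b * nonArc X b c) ρ
    fits≡ (a ∷ b ∷ c ∷ []) τ _ ∣τ∣ = trans (cong χ (begin
      fits X (monomial₃ m) (a ∷ b ∷ c ∷ τ)
        ≡⟨ fits-∷∷ X 1 1 _ a b (c ∷ τ) ⟩
      (not (X a b) ∨ false) ∧ fits X (1 ∷ 1 ∷ upFrom 2 m) (b ∷ c ∷ τ)
        ≡⟨ cong ((not (X a b) ∨ false) ∧_) (fits-∷∷ X 1 1 _ b c τ) ⟩
      (not (X a b) ∨ false) ∧ ((not (X b c) ∨ false) ∧ fits X (upFrom 1 (suc m)) (c ∷ τ))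
        ≡⟨ cong₂ (λ p q → p ∧ (q ∧ fits X (upFrom 1 (suc m)) (c ∷ τ))) (∨-identityʳ (not (X a b))) (∨-identityʳ (not (X b c))) ⟩
      not (X a b) ∧ (not (X b c) ∧ fits X (upFrom 1 (suc m)) (c ∷ τ))
        ≡⟨ cong (λ r → not (X a b) ∧ (not (X b c) ∧ r)) (fits-upFrom X (c ∷ τ) 1 (suc m) (≤-reflexive (cong suc ∣τ∣))) ⟩
      not (X a b) ∧ (not (X b c) ∧ true)
        ≡⟨ cong (not (X a b) ∧_) (∧-identityʳ _) ⟩
      not (X a b) ∧ not (X b c) ∎)) (χ-∧ (not (X a b)) (not (X b c)))
      where open ≡-Reasoning

  U-monomial₂₂ : 4 + m ≡ n → U X (monomial₂₂ m) ≡ m ! * nonArcPairs X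
  U-monomial₂₂ 4+m≡n =
    U-coefficient X (monomial₂₂ m) 4 m (trans (cong (4 +_) (length-upFrom 3 m)) 4+m≡n) 4+m≡n
      (onQuadruples λ a b c d → nonArc X a b * nonArc X c d) fits≡
    where
    fits≡ : ∀ ρ τ → length ρ ≡ 4 → length τ ≡ m →
      χ (fits X (monomial₂₂ m) (ρ ++ τ)) ≡ onQuadruples (λ a b c d → nonArc X a b * nonArc X c d) ρ
    fits≡ (a ∷ b ∷ c ∷ d ∷ []) τ _ ∣τ∣ = trans (cong χ (begin
      fits X (monomial₂₂ m) (a ∷ b ∷ c ∷ d ∷ τ)
        ≡⟨ fits-∷∷ X 1 1 _ a b (c ∷ d ∷ τ) ⟩
      (not (X a b) ∨ false) ∧ fits X (1 ∷ 2 ∷ 2 ∷ upFrom 3 m) (b ∷ c ∷ d ∷ τ)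
        ≡⟨ cong ((not (X a b) ∨ false) ∧_) (fits-∷∷ X 1 2 _ b c (d ∷ τ)) ⟩
      (not (X a b) ∨ false) ∧ ((not (X b c) ∨ true) ∧ fits X (2 ∷ 2 ∷ upFrom 3 m) (c ∷ d ∷ τ))
        ≡⟨ cong (λ r → (not (X a b) ∨ false) ∧ ((not (X b c) ∨ true) ∧ r)) (fits-∷∷ X 2 2 _ c d τ) ⟩
      (not (X a b) ∨ false) ∧ ((not (X b c) ∨ true) ∧ ((not (X c d) ∨ false) ∧ fits X (upFrom 2 (suc m)) (d ∷ τ)))
        ≡⟨ cong (λ r → (not (X a b) ∨ false) ∧ ((not (X b c) ∨ true) ∧ ((not (X c d) ∨ false) ∧ r)))
                (fits-upFrom X (d ∷ τ) 2 (suc m) (≤-reflexive (cong suc ∣τ∣))) ⟩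
      (not (X a b) ∨ false) ∧ ((not (X b c) ∨ true) ∧ ((not (X c d) ∨ false) ∧ true))
        ≡⟨ cong₂ _∧_ (∨-identityʳ (not (X a b)))
             (cong₂ _∧_ (∨-zeroʳ (not (X b c))) (trans (∧-identityʳ _) (∨-identityʳ (not (X c d))))) ⟩
      not (X a b) ∧ not (X c d) ∎)) (χ-∧ (not (X a b)) (not (X c d)))
      where open ≡-Reasoning

U-determines-size : ∀ {n n′} (X : Digraph n) (Y : Digraph n′) → U X ≈S U Y → n ≡ n′
U-determines-size {n} {n′} X Y U≈ with n Data.Nat.≟ n′
... | yes n≡n′ = n≡n′
... | no  n≢n′ = ⊥-elim (<-irrefl refl (begin-strict
  0                 <⟨ 1≤n! n ⟩
  n !               ≡⟨ sym (U-upFrom X) ⟩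
  U X (upFrom 1 n)  ≡⟨ U≈ (upFrom 1 n) (monomial-upFrom 1 n) ⟩
  U Y (upFrom 1 n)  ≡⟨ U-coefficient-length≢ Y (upFrom 1 n) (n≢n′ ∘ trans (sym (length-upFrom 1 n))) ⟩
  0                 ∎))
  where open ≤-Reasoning

module _ {n : ℕ} (X Y : Digraph n) (U≈ : U X ≈S U Y) where

  private
    U-determines-count : ∀ k (w : ℕ → List ℕ) → (∀ m → Monomial (w m)) → ∀ {cX cY} →
      (n < k → cX ≡ 0) → (n < k → cY ≡ 0) →
      (∀ m → k + m ≡ n → U X (w m) ≡ m ! * cX) → (∀ m → k + m ≡ n → U Y (w m) ≡ m ! * cY) → cX ≡ cY
    U-determines-count k w monomial cX≡0 cY≡0 U-X U-Y with k Data.Nat.≤? n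
    ... | no  k≰n = trans (cX≡0 (≰⇒> k≰n)) (sym (cY≡0 (≰⇒> k≰n)))
    ... | yes k≤n = *-cancelˡ-≡ _ _ (m !) {{m !≢0}}
                      (trans (sym (U-X m k+m≡n)) (trans (U≈ (w m) (monomial m)) (U-Y m k+m≡n)))
      where
      m : ℕ
      m = n ∸ k
      k+m≡n : k + m ≡ n
      k+m≡n = m+[n∸m]≡n k≤n

  U-determines-nonArcs : nonArcs X ≡ nonArcs Y
  U-determines-nonArcs = U-determines-count 2 monomial₂ (λ m → ≤-refl ∷ monomial-∷-upFrom 2 m (s≤s z≤n))
    (∑ᴸ-distinct-pigeonhole 2 (onPairs (nonArc X))) (∑ᴸ-distinct-pigeonhole 2 (onPairs (nonArc Y)))
    (U-monomial₂ X) (U-monomial₂ Y)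

  U-determines-nonArcPaths : nonArcPaths X ≡ nonArcPaths Y
  U-determines-nonArcPaths = U-determines-count 3 monomial₃ (λ m → ≤-refl ∷ ≤-refl ∷ monomial-∷-upFrom 2 m (s≤s z≤n))
    (∑ᴸ-distinct-pigeonhole 3 (onTriples λ a b c → nonArc X a b * nonArc X b c))
    (∑ᴸ-distinct-pigeonhole 3 (onTriples λ a b c → nonArc Y a b * nonArc Y b c))
    (U-monomial₃ X) (U-monomial₃ Y)

  U-determines-nonArcPairs : nonArcPairs X ≡ nonArcPairs Y
  U-determines-nonArcPairs = U-determines-count 4 monomial₂₂
    (λ m → ≤-refl ∷ s≤s z≤n ∷ ≤-refl ∷ monomial-∷-upFrom 3 m (s≤s (s≤s z≤n)))
    (∑ᴸ-distinct-pigeonhole 4 (onQuadruples λ a b c d → nonArc X a b * nonArc X c d))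
    (∑ᴸ-distinct-pigeonhole 4 (onQuadruples λ a b c d → nonArc Y a b * nonArc Y c d))
    (U-monomial₂₂ X) (U-monomial₂₂ Y)

-- Symmetrisation over orderings of pairs and triples

module _ {n : ℕ} where

  sym₂ : (Fin n → Fin n → ℕ) → Fin n → Fin n → ℕ
  sym₂ h x y = h x y + h y x

  sym₆ : (Fin n → Fin n → Fin n → ℕ) → Fin n → Fin n → Fin n → ℕ
  sym₆ h x y z = h x y z + (h y x z + (h x z y + (h z y x + (h y z x + h z x y))))

  ∑₂-distrib-+ : ∀ (h k : Fin n → Fin n → ℕ) → ∑₂ (λ x y → h x y + k x y) ≡ ∑₂ h + ∑₂ k
  ∑₂-distrib-+ h k = trans (sum-cong-≗ (λ y → ∑-distrib-+ (λ x → h x y) (λ x → k x y)))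
    (∑-distrib-+ (λ y → ∑[ x < n ] h x y) (λ y → ∑[ x < n ] k x y))

  ∑₃-distrib-+ : ∀ (h k : Fin n → Fin n → Fin n → ℕ) → ∑₃ (λ x y z → h x y z + k x y z) ≡ ∑₃ h + ∑₃ k
  ∑₃-distrib-+ h k = trans (sum-cong-≗ (λ z → ∑₂-distrib-+ (λ x y → h x y z) (λ x y → k x y z)))
    (∑-distrib-+ (λ z → ∑₂ (λ x y → h x y z)) (λ z → ∑₂ (λ x y → k x y z)))

  *-distribˡ-∑₂ : ∀ c (h : Fin n → Fin n → ℕ) → c * ∑₂ h ≡ ∑₂ (λ x y → c * h x y)
  *-distribˡ-∑₂ c h = trans (*-distribˡ-sum c (λ y → ∑[ x < n ] h x y)) (sum-cong-≗ (λ y → *-distribˡ-sum c (λ x → h x y)))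

  *-distribˡ-∑₃ : ∀ c (h : Fin n → Fin n → Fin n → ℕ) → c * ∑₃ h ≡ ∑₃ (λ x y z → c * h x y z)
  *-distribˡ-∑₃ c h = trans (*-distribˡ-sum c (λ z → ∑₂ (λ x y → h x y z))) (sum-cong-≗ (λ z → *-distribˡ-∑₂ c (λ x y → h x y z)))

  ∑₃-swap₁₂ : ∀ (h : Fin n → Fin n → Fin n → ℕ) → ∑₃ (λ x y z → h y x z) ≡ ∑₃ h
  ∑₃-swap₁₂ h = sum-cong-≗ (λ z → ∑-comm (λ y x → h y x z))

  ∑₃-swap₂₃ : ∀ (h : Fin n → Fin n → Fin n → ℕ) → ∑₃ (λ x y z → h x z y) ≡ ∑₃ h
  ∑₃-swap₂₃ h = ∑-comm (λ z y → ∑[ x < n ] h x z y)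

  ∑₂-sym₂ : ∀ (h : Fin n → Fin n → ℕ) → ∑₂ (sym₂ h) ≡ 2 * ∑₂ h
  ∑₂-sym₂ h = trans (∑₂-distrib-+ h _) (cong (∑₂ h +_) (trans (∑-comm h) (sym (+-identityʳ _))))

  ∑₃-sym₆ : ∀ (h : Fin n → Fin n → Fin n → ℕ) → ∑₃ (sym₆ h) ≡ 6 * ∑₃ h
  ∑₃-sym₆ h = begin
    ∑₃ (sym₆ h)
      ≡⟨ ∑₃-distrib-+ h _ ⟩
    ∑₃ h + ∑₃ (λ x y z → h y x z + (h x z y + (h z y x + (h y z x + h z x y))))
      ≡⟨ cong (∑₃ h +_) (trans (∑₃-distrib-+ _ _) (cong₂ _+_ (∑₃-swap₁₂ h)
           (trans (∑₃-distrib-+ _ _) (cong₂ _+_ (∑₃-swap₂₃ h)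
             (trans (∑₃-distrib-+ _ _) (cong₂ _+_ zyx
               (trans (∑₃-distrib-+ _ _) (cong₂ _+_ yzx zxy)))))))) ⟩
    ∑₃ h + (∑₃ h + (∑₃ h + (∑₃ h + (∑₃ h + ∑₃ h))))
      ≡⟨ cong (λ s → ∑₃ h + (∑₃ h + (∑₃ h + (∑₃ h + (∑₃ h + s))))) (sym (+-identityʳ (∑₃ h))) ⟩
    6 * ∑₃ h ∎
    where
    open ≡-Reasoning
    zxy : ∑₃ (λ x y z → h z x y) ≡ ∑₃ h
    zxy = trans (∑₃-swap₂₃ (λ x y z → h y x z)) (∑₃-swap₁₂ h)
    zyx : ∑₃ (λ x y z → h z y x) ≡ ∑₃ h
    zyx = trans (∑₃-swap₁₂ (λ x y z → h z x y)) zxy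
    yzx : ∑₃ (λ x y z → h y z x) ≡ ∑₃ h
    yzx = trans (∑₃-swap₁₂ (λ x y z → h x z y)) (∑₃-swap₂₃ h)

  ∑₂-cong-sym₂ : ∀ {h k : Fin n → Fin n → ℕ} → (∀ x y → sym₂ h x y ≡ sym₂ k x y) → ∑₂ h ≡ ∑₂ k
  ∑₂-cong-sym₂ {h} {k} sym≡ = *-cancelˡ-≡ _ _ 2
    (trans (sym (∑₂-sym₂ h)) (trans (∑₂-cong sym≡) (∑₂-sym₂ k)))

  ∑₃-cong-sym₆ : ∀ {h k : Fin n → Fin n → Fin n → ℕ} → (∀ x y z → sym₆ h x y z ≡ sym₆ k x y z) → ∑₃ h ≡ ∑₃ k
  ∑₃-cong-sym₆ {h} {k} sym≡ = *-cancelˡ-≡ _ _ 6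
    (trans (sym (∑₃-sym₆ h)) (trans (∑₃-cong sym≡) (∑₃-sym₆ k)))

  private
    factor₆ : ∀ {c c₂ c₃ c₄ c₅ c₆} k₁ k₂ k₃ k₄ k₅ k₆ → c₂ ≡ c → c₃ ≡ c → c₄ ≡ c → c₅ ≡ c → c₆ ≡ c →
      c * k₁ + (c₂ * k₂ + (c₃ * k₃ + (c₄ * k₄ + (c₅ * k₅ + c₆ * k₆)))) ≡ c * (k₁ + (k₂ + (k₃ + (k₄ + (k₅ + k₆)))))
    factor₆ {c} k₁ k₂ k₃ k₄ k₅ k₆ refl refl refl refl refl =
      sym (trans (*-distribˡ-+ c k₁ _) (cong (c * k₁ +_) (trans (*-distribˡ-+ c k₂ _) (cong (c * k₂ +_)
        (trans (*-distribˡ-+ c k₃ _) (cong (c * k₃ +_) (trans (*-distribˡ-+ c k₄ _) (cong (c * k₄ +_)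
          (*-distribˡ-+ c k₅ k₆)))))))))

  sym₆-symmetric-factor : ∀ (g : Fin n → Fin n → Fin n → ℕ) →
    (∀ x y z → g y x z ≡ g x y z) → (∀ x y z → g x z y ≡ g x y z) →
    ∀ (k : Fin n → Fin n → Fin n → ℕ) x y z → sym₆ (λ x y z → g x y z * k x y z) x y z ≡ g x y z * sym₆ k x y z
  sym₆-symmetric-factor g g₁₂ g₂₃ k x y z =
    factor₆ (k x y z) (k y x z) (k x z y) (k z y x) (k y z x) (k z x y) (g₁₂ x y z) (g₂₃ x y z) g-zyx g-yzx g-zxy
    where
    g-yzx : g y z x ≡ g x y z
    g-yzx = trans (g₂₃ y x z) (g₁₂ x y z)
    g-zyx : g z y x ≡ g x y z
    g-zyx = trans (g₁₂ y z x) g-yzx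
    g-zxy : g z x y ≡ g x y z
    g-zxy = trans (g₂₃ z y x) g-zyx

  distinct₂-flip : ∀ x y → distinct₂ y x ≡ distinct₂ x y
  distinct₂-flip x y = distinct-↭ {n} (↭.swap {xs = []} y x ↭.refl)

  distinct₃-swap₁₂ : ∀ x y z → distinct₃ y x z ≡ distinct₃ x y z
  distinct₃-swap₁₂ x y z = distinct-↭ {n} (↭.swap {xs = z ∷ []} y x ↭.refl)

  distinct₃-swap₂₃ : ∀ x y z → distinct₃ x z y ≡ distinct₃ x y z
  distinct₃-swap₂₃ x y z = distinct-↭ {n} (↭.prep x (↭.swap {xs = []} z y ↭.refl))

  ∑₂-distinct-cong-sym₂ : ∀ (h k : Fin n → Fin n → ℕ) → (∀ x y → distinct₂ x y ≡ true → sym₂ h x y ≡ sym₂ k x y) →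
    ∑₂ (λ x y → χ (distinct₂ x y) * h x y) ≡ ∑₂ (λ x y → χ (distinct₂ x y) * k x y)
  ∑₂-distinct-cong-sym₂ h k sym≡ = ∑₂-cong-sym₂ λ x y → begin
    χ (distinct₂ x y) * h x y + χ (distinct₂ y x) * h y x
      ≡⟨ cong (λ d → χ (distinct₂ x y) * h x y + χ d * h y x) (distinct₂-flip x y) ⟩
    χ (distinct₂ x y) * h x y + χ (distinct₂ x y) * h y x  ≡⟨ sym (*-distribˡ-+ (χ (distinct₂ x y)) _ _) ⟩
    χ (distinct₂ x y) * sym₂ h x y                         ≡⟨ χ*-cong (distinct₂ x y) (sym≡ x y) ⟩
    χ (distinct₂ x y) * sym₂ k x y                         ≡⟨ *-distribˡ-+ (χ (distinct₂ x y)) _ _ ⟩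
    χ (distinct₂ x y) * k x y + χ (distinct₂ x y) * k y x
      ≡⟨ cong (λ d → χ (distinct₂ x y) * k x y + χ d * k y x) (sym (distinct₂-flip x y)) ⟩
    χ (distinct₂ x y) * k x y + χ (distinct₂ y x) * k y x  ∎
    where open ≡-Reasoning

  ∑₃-distinct-cong-sym₆ : ∀ (h k : Fin n → Fin n → Fin n → ℕ) → (∀ x y z → distinct₃ x y z ≡ true → sym₆ h x y z ≡ sym₆ k x y z) →
    ∑₃ (λ x y z → χ (distinct₃ x y z) * h x y z) ≡ ∑₃ (λ x y z → χ (distinct₃ x y z) * k x y z)
  ∑₃-distinct-cong-sym₆ h k sym≡ = ∑₃-cong-sym₆ λ x y z → begin
    sym₆ (λ x y z → d x y z * h x y z) x y z  ≡⟨ sym₆-symmetric-factor d d₁₂ d₂₃ h x y z ⟩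
    d x y z * sym₆ h x y z                     ≡⟨ χ*-cong (distinct₃ x y z) (sym≡ x y z) ⟩
    d x y z * sym₆ k x y z                     ≡⟨ sym (sym₆-symmetric-factor d d₁₂ d₂₃ k x y z) ⟩
    sym₆ (λ x y z → d x y z * k x y z) x y z  ∎
    where
    open ≡-Reasoning
    d : Fin n → Fin n → Fin n → ℕ
    d x y z = χ (distinct₃ x y z)
    d₁₂ : ∀ x y z → d y x z ≡ d x y z
    d₁₂ x y z = cong χ (distinct₃-swap₁₂ x y z)
    d₂₃ : ∀ x y z → d x z y ≡ d x y z
    d₂₃ x y z = cong χ (distinct₃-swap₂₃ x y z)

-- Squaring a sum over pairs of distinct vertices

-- Bit versions of distinct₂, distinct₃, distinct₄: distinct₃ a b c computes to
-- distinct₃ᵇ ⌊ a ≟ b ⌋ ⌊ a ≟ c ⌋ ⌊ b ≟ c ⌋, and similarly for the others.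
distinct₂ᵇ : Bool → Bool
distinct₂ᵇ eab = not (eab ∨ false) ∧ true

distinct₃ᵇ : Bool → Bool → Bool → Bool
distinct₃ᵇ eab eac ebc = not (eab ∨ (eac ∨ false)) ∧ (not (ebc ∨ false) ∧ true)

distinct₄ᵇ : Bool⁶ Bool
distinct₄ᵇ eab eac ead ebc ebd ecd =
  not (eab ∨ (eac ∨ (ead ∨ false))) ∧ (not (ebc ∨ (ebd ∨ false)) ∧ (not (ecd ∨ false) ∧ true))

transitive₃ᵇ : Bool → Bool → Bool → Bool
transitive₃ᵇ euv euw evw = not (euv ∧ evw ∧ not euw) ∧ not (euv ∧ euw ∧ not evw) ∧ not (euw ∧ evw ∧ not euv)

equality₄ᵇ : Bool⁶ Bool
equality₄ᵇ eab eac ead ebc ebd ecd =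
  transitive₃ᵇ eab eac ebc ∧ transitive₃ᵇ eab ead ebd ∧ transitive₃ᵇ eac ead ecd ∧ transitive₃ᵇ ebc ebd ecd

pairProductᴸ pairProductᴿ : Bool⁶ ℕ
pairProductᴸ eab eac ead ebc ebd ecd = χ (distinct₂ᵇ eab) * χ (distinct₂ᵇ ecd)
pairProductᴿ eab eac ead ebc ebd ecd =
  χ (distinct₄ᵇ eab eac ead ebc ebd ecd) +
  (χ eac * χ (distinct₃ᵇ eab ead ebd) + (χ ebc * χ (distinct₃ᵇ eab ead ebd) +
  (χ ead * χ (distinct₃ᵇ eab eac ebc) + (χ ebd * χ (distinct₃ᵇ eab eac ebc) +
  (χ ebd * (χ eac * χ (distinct₂ᵇ eab)) + χ ead * (χ ebc * χ (distinct₂ᵇ eab)))))))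

pairProduct-identity : Identity⁶ equality₄ᵇ pairProductᴸ pairProductᴿ
pairProduct-identity = from-yes (identity⁶? equality₄ᵇ pairProductᴸ pairProductᴿ)

module _ {n : ℕ} where

  transitive₃ᵇ-≟ : ∀ (u v w : Fin n) → transitive₃ᵇ ⌊ u ≟ v ⌋ ⌊ u ≟ w ⌋ ⌊ v ≟ w ⌋ ≡ true
  transitive₃ᵇ-≟ u v w with u ≟ v | u ≟ w | v ≟ w
  ... | yes _   | yes _   | yes _   = refl
  ... | yes u≡v | yes u≡w | no  v≢w = ⊥-elim (v≢w (trans (sym u≡v) u≡w))
  ... | yes u≡v | no  u≢w | yes v≡w = ⊥-elim (u≢w (trans u≡v v≡w))
  ... | yes _   | no  _   | no  _   = refl
  ... | no  u≢v | yes u≡w | yes v≡w = ⊥-elim (u≢v (trans u≡w (sym v≡w)))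
  ... | no  _   | yes _   | no  _   = refl
  ... | no  _   | no  _   | yes _   = refl
  ... | no  _   | no  _   | no  _   = refl

  distinct-pairs-product : ∀ a b c d → χ (distinct₂ a b) * χ (distinct₂ c d) ≡
    χ (distinct₄ a b c d) +
    (χ ⌊ a ≟ c ⌋ * χ (distinct₃ a b d) + (χ ⌊ b ≟ c ⌋ * χ (distinct₃ a b d) +
    (χ ⌊ a ≟ d ⌋ * χ (distinct₃ a b c) + (χ ⌊ b ≟ d ⌋ * χ (distinct₃ a b c) +
    (χ ⌊ b ≟ d ⌋ * (χ ⌊ a ≟ c ⌋ * χ (distinct₂ a b)) + χ ⌊ a ≟ d ⌋ * (χ ⌊ b ≟ c ⌋ * χ (distinct₂ a b)))))))
  distinct-pairs-product a b c d =
    pairProduct-identity ⌊ a ≟ b ⌋ ⌊ a ≟ c ⌋ ⌊ a ≟ d ⌋ ⌊ b ≟ c ⌋ ⌊ b ≟ d ⌋ ⌊ c ≟ d ⌋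
      (∧-true (transitive₃ᵇ-≟ a b c) (∧-true (transitive₃ᵇ-≟ a b d) (∧-true (transitive₃ᵇ-≟ a c d) (transitive₃ᵇ-≟ b c d))))

  ∑-δ′ : ∀ (a : Fin n) (h : Fin n → ℕ) → ∑[ c < n ] (χ ⌊ a ≟ c ⌋ * h c) ≡ h a
  ∑-δ′ a h = trans (sum-cong-≗ (λ c → cong (λ e → χ e * h c) (⌊≟⌋-sym a c))) (∑-δ a h)

  ∑₂-δ₁ : ∀ a (H : Fin n → Fin n → ℕ) → ∑₂ (λ c d → χ ⌊ a ≟ c ⌋ * H c d) ≡ ∑[ d < n ] H a d
  ∑₂-δ₁ a H = sum-cong-≗ (λ d → ∑-δ′ a (λ c → H c d))

  ∑₂-δ₂ : ∀ a (H : Fin n → Fin n → ℕ) → ∑₂ (λ c d → χ ⌊ a ≟ d ⌋ * H c d) ≡ ∑[ c < n ] H c a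
  ∑₂-δ₂ a H = trans (sum-cong-≗ (λ d → sym (*-distribˡ-sum (χ ⌊ a ≟ d ⌋) (λ c → H c d))))
                      (∑-δ′ a (λ d → ∑[ c < n ] H c d))

  ∑₂-δδ : ∀ a b (H : Fin n → Fin n → ℕ) → ∑₂ (λ c d → χ ⌊ b ≟ d ⌋ * (χ ⌊ a ≟ c ⌋ * H c d)) ≡ H a b
  ∑₂-δδ a b H = trans (∑₂-δ₂ b (λ c d → χ ⌊ a ≟ c ⌋ * H c d)) (∑-δ′ a (λ c → H c b))

  ∑₂-∑ : ∀ (G : Fin n → Fin n → Fin n → ℕ) → ∑₂ (λ a b → ∑[ c < n ] G a b c) ≡ ∑₃ G
  ∑₂-∑ G = trans (sum-cong-≗ (λ b → ∑-comm (λ a c → G a b c))) (∑-comm (λ b c → ∑[ a < n ] G a b c))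

  ∑₂-∑₂ : ∀ (H : Fin n → Fin n → Fin n → Fin n → ℕ) → ∑₂ (λ a b → ∑₂ (λ c d → H a b c d)) ≡ ∑₄ H
  ∑₂-∑₂ H = trans (∑₂-∑ (λ a b d → ∑[ c < n ] H a b c d)) (sum-cong-≗ (λ d → ∑₂-∑ (λ a b c → H a b c d)))

  ∑₂-* : ∀ (h k : Fin n → Fin n → ℕ) → ∑₂ h * ∑₂ k ≡ ∑₂ (λ a b → ∑₂ (λ c d → h a b * k c d))
  ∑₂-* h k = trans (*-distribʳ-sum (∑₂ k) (λ b → ∑[ a < n ] h a b))
    (sum-cong-≗ (λ b → trans (*-distribʳ-sum (∑₂ k) (λ a → h a b)) (sum-cong-≗ (λ a → *-distribˡ-∑₂ (h a b) k))))

  ∑₂∑₂-distrib-+ : ∀ (h k : Fin n → Fin n → Fin n → Fin n → ℕ) →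
    ∑₂ (λ a b → ∑₂ (λ c d → h a b c d + k a b c d)) ≡ ∑₂ (λ a b → ∑₂ (h a b)) + ∑₂ (λ a b → ∑₂ (k a b))
  ∑₂∑₂-distrib-+ h k = trans (∑₂-cong (λ a b → ∑₂-distrib-+ (h a b) (k a b)))
                               (∑₂-distrib-+ (λ a b → ∑₂ (h a b)) (λ a b → ∑₂ (k a b)))

  -- Splitting by how the second pair meets the first one.
  ∑₂-distinct-square : ∀ (f : Fin n → Fin n → ℕ) →
    ∑₂ (λ a b → χ (distinct₂ a b) * f a b) * ∑₂ (λ a b → χ (distinct₂ a b) * f a b) ≡
    ∑₄ (λ a b c d → χ (distinct₄ a b c d) * (f a b * f c d)) +
    (∑₃ (λ a b c → χ (distinct₃ a b c) * (f a b * f a c)) +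
    (∑₃ (λ a b c → χ (distinct₃ a b c) * (f a b * f b c)) +
    (∑₃ (λ a b c → χ (distinct₃ a b c) * (f a b * f c a)) +
    (∑₃ (λ a b c → χ (distinct₃ a b c) * (f a b * f c b)) +
    (∑₂ (λ a b → χ (distinct₂ a b) * (f a b * f a b)) +
     ∑₂ (λ a b → χ (distinct₂ a b) * (f a b * f b a)))))))
  ∑₂-distinct-square f = begin
    ∑₂ w * ∑₂ w
      ≡⟨ ∑₂-* w w ⟩
    ∑₂ (λ a b → ∑₂ (λ c d → w a b * w c d))
      ≡⟨ ∑₂-cong (λ a b → sum-cong-≗ (λ d → sum-cong-≗ (λ c → split a b c d))) ⟩
    ∑₂ (λ a b → ∑₂ (λ c d → t₁ a b c d + (t₂ a b c d + (t₃ a b c d + (t₄ a b c d + (t₅ a b c d + (t₆ a b c d + t₇ a b c d)))))))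
      ≡⟨ trans (∑₂∑₂-distrib-+ _ _) (cong₂ _+_ (∑₂-∑₂ _) (trans (∑₂∑₂-distrib-+ _ _) (cong₂ _+_ collapse₂
           (trans (∑₂∑₂-distrib-+ _ _) (cong₂ _+_ collapse₃ (trans (∑₂∑₂-distrib-+ _ _) (cong₂ _+_ collapse₄
             (trans (∑₂∑₂-distrib-+ _ _) (cong₂ _+_ collapse₅ (trans (∑₂∑₂-distrib-+ _ _) (cong₂ _+_ collapse₆ collapse₇))))))))))) ⟩
    _ ∎
    where
    open ≡-Reasoning
    open +-*-Solver
    w : Fin n → Fin n → ℕ
    w a b = χ (distinct₂ a b) * f a b
    K : Fin n → Fin n → Fin n → Fin n → ℕ
    K a b c d = f a b * f c d
    t₁ t₂ t₃ t₄ t₅ t₆ t₇ : Fin n → Fin n → Fin n → Fin n → ℕ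
    t₁ a b c d = χ (distinct₄ a b c d) * K a b c d
    t₂ a b c d = χ ⌊ a ≟ c ⌋ * (χ (distinct₃ a b d) * K a b c d)
    t₃ a b c d = χ ⌊ b ≟ c ⌋ * (χ (distinct₃ a b d) * K a b c d)
    t₄ a b c d = χ ⌊ a ≟ d ⌋ * (χ (distinct₃ a b c) * K a b c d)
    t₅ a b c d = χ ⌊ b ≟ d ⌋ * (χ (distinct₃ a b c) * K a b c d)
    t₆ a b c d = χ ⌊ b ≟ d ⌋ * (χ ⌊ a ≟ c ⌋ * (χ (distinct₂ a b) * K a b c d))
    t₇ a b c d = χ ⌊ a ≟ d ⌋ * (χ ⌊ b ≟ c ⌋ * (χ (distinct₂ a b) * K a b c d))
    split : ∀ a b c d → w a b * w c d ≡ t₁ a b c d + (t₂ a b c d + (t₃ a b c d + (t₄ a b c d + (t₅ a b c d + (t₆ a b c d + t₇ a b c d)))))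
    split a b c d =
      trans (solve 4 (λ x y u v → (x :* u) :* (y :* v) := (x :* y) :* (u :* v)) refl
                 (χ (distinct₂ a b)) (χ (distinct₂ c d)) (f a b) (f c d))
     (trans (cong (_* K a b c d) (distinct-pairs-product a b c d))
       (solve 16 (λ d₄ e₂ d₂ e₃ d₃ e₄ d₄′ e₅ d₅ e₆ e₆′ p e₇ e₇′ p′ k →
                 (d₄ :+ (e₂ :* d₂ :+ (e₃ :* d₃ :+ (e₄ :* d₄′ :+ (e₅ :* d₅ :+ (e₆ :* (e₆′ :* p) :+ e₇ :* (e₇′ :* p′))))))) :* k :=
                 d₄ :* k :+ (e₂ :* (d₂ :* k) :+ (e₃ :* (d₃ :* k) :+ (e₄ :* (d₄′ :* k) :+ (e₅ :* (d₅ :* k) :+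
                   (e₆ :* (e₆′ :* (p :* k)) :+ e₇ :* (e₇′ :* (p′ :* k))))))))
              refl (χ (distinct₄ a b c d)) (χ ⌊ a ≟ c ⌋) (χ (distinct₃ a b d)) (χ ⌊ b ≟ c ⌋) (χ (distinct₃ a b d))
                   (χ ⌊ a ≟ d ⌋) (χ (distinct₃ a b c)) (χ ⌊ b ≟ d ⌋) (χ (distinct₃ a b c))
                   (χ ⌊ b ≟ d ⌋) (χ ⌊ a ≟ c ⌋) (χ (distinct₂ a b)) (χ ⌊ a ≟ d ⌋) (χ ⌊ b ≟ c ⌋) (χ (distinct₂ a b)) (K a b c d)))
    collapse₂ : ∑₂ (λ a b → ∑₂ (t₂ a b)) ≡ ∑₃ (λ a b c → χ (distinct₃ a b c) * (f a b * f a c))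
    collapse₂ = trans (∑₂-cong (λ a b → ∑₂-δ₁ a (λ c d → χ (distinct₃ a b d) * K a b c d))) (∑₂-∑ _)
    collapse₃ : ∑₂ (λ a b → ∑₂ (t₃ a b)) ≡ ∑₃ (λ a b c → χ (distinct₃ a b c) * (f a b * f b c))
    collapse₃ = trans (∑₂-cong (λ a b → ∑₂-δ₁ b (λ c d → χ (distinct₃ a b d) * K a b c d))) (∑₂-∑ _)
    collapse₄ : ∑₂ (λ a b → ∑₂ (t₄ a b)) ≡ ∑₃ (λ a b c → χ (distinct₃ a b c) * (f a b * f c a))
    collapse₄ = trans (∑₂-cong (λ a b → ∑₂-δ₂ a (λ c d → χ (distinct₃ a b c) * K a b c d))) (∑₂-∑ _)
    collapse₅ : ∑₂ (λ a b → ∑₂ (t₅ a b)) ≡ ∑₃ (λ a b c → χ (distinct₃ a b c) * (f a b * f c b))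
    collapse₅ = trans (∑₂-cong (λ a b → ∑₂-δ₂ b (λ c d → χ (distinct₃ a b c) * K a b c d))) (∑₂-∑ _)
    collapse₆ : ∑₂ (λ a b → ∑₂ (t₆ a b)) ≡ ∑₂ (λ a b → χ (distinct₂ a b) * (f a b * f a b))
    collapse₆ = ∑₂-cong (λ a b → ∑₂-δδ a b (λ c d → χ (distinct₂ a b) * K a b c d))
    collapse₇ : ∑₂ (λ a b → ∑₂ (t₇ a b)) ≡ ∑₂ (λ a b → χ (distinct₂ a b) * (f a b * f b a))
    collapse₇ = ∑₂-cong (λ a b → ∑₂-δδ b a (λ c d → χ (distinct₂ a b) * K a b c d))

module _ {n : ℕ} (X : Digraph n) where

  mutualNonArcs : ℕ
  mutualNonArcs = ∑₂ λ a b → χ (distinct₂ a b) * (nonArc X a b * nonArc X b a)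

  overlappingNonArcs : ℕ
  overlappingNonArcs = ∑₃ λ a b c →
    χ (distinct₃ a b c) * (nonArc X a b * (nonArc X a c + (nonArc X b c + (nonArc X c a + nonArc X c b))))

  nonArcs-square : nonArcs X * nonArcs X ≡ nonArcPairs X + (overlappingNonArcs + (nonArcs X + mutualNonArcs))
  nonArcs-square = begin
    nonArcs X * nonArcs X
      ≡⟨ ∑₂-distinct-square f ⟩
    nonArcPairs X + (L₁ + (L₂ + (L₃ + (L₄ + (∑₂ (λ a b → χ (distinct₂ a b) * (f a b * f a b)) + mutualNonArcs)))))
      ≡⟨ cong (nonArcPairs X +_) (solve 6 (λ l₁ l₂ l₃ l₄ s m → l₁ :+ (l₂ :+ (l₃ :+ (l₄ :+ (s :+ m)))) :=
                                                              (l₁ :+ (l₂ :+ (l₃ :+ l₄))) :+ (s :+ m))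
                                      refl L₁ L₂ L₃ L₄ _ mutualNonArcs) ⟩
    nonArcPairs X + ((L₁ + (L₂ + (L₃ + L₄))) + (∑₂ (λ a b → χ (distinct₂ a b) * (f a b * f a b)) + mutualNonArcs))
      ≡⟨ cong (nonArcPairs X +_) (cong₂ _+_ (sym overlapping-split)
           (cong (_+ mutualNonArcs) (∑₂-cong (λ a b → cong (χ (distinct₂ a b) *_) (χ-idem (not (X a b))))))) ⟩
    nonArcPairs X + (overlappingNonArcs + (nonArcs X + mutualNonArcs)) ∎
    where
    open ≡-Reasoning
    open +-*-Solver
    f : Fin n → Fin n → ℕ
    f = nonArc X
    w : (Fin n → Fin n → Fin n → ℕ) → Fin n → Fin n → Fin n → ℕ
    w g a b c = χ (distinct₃ a b c) * (f a b * g a b c)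
    L₁ L₂ L₃ L₄ : ℕ
    L₁ = ∑₃ (w λ a b c → f a c)
    L₂ = ∑₃ (w λ a b c → f b c)
    L₃ = ∑₃ (w λ a b c → f c a)
    L₄ = ∑₃ (w λ a b c → f c b)
    overlapping-split : overlappingNonArcs ≡ L₁ + (L₂ + (L₃ + L₄))
    overlapping-split =
      trans (∑₃-cong λ a b c →
               solve 6 (λ d x y z u v → d :* (x :* (y :+ (z :+ (u :+ v)))) :=
                                        d :* (x :* y) :+ (d :* (x :* z) :+ (d :* (x :* u) :+ d :* (x :* v))))
                 refl (χ (distinct₃ a b c)) (f a b) (f a c) (f b c) (f c a) (f c b))
     (trans (∑₃-distrib-+ (w λ a b c → f a c) _) (cong (L₁ +_)
       (trans (∑₃-distrib-+ (w λ a b c → f b c) _) (cong (L₂ +_)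
         (∑₃-distrib-+ (w λ a b c → f c a) (w λ a b c → f c b))))))

transitiveᵇ : Bool → Bool → Bool → Bool
transitiveᵇ uv vw uw = not (uv ∧ vw ∧ not uw)

-- Bit vectors in Bool⁶ describe a relation on an ordered triple (x, y, z), listing
-- x→y, y→x, x→z, z→x, y→z, z→y in this order.
onTriple : ∀ {n} → Digraph n → Bool⁶ ℕ → Fin n → Fin n → Fin n → ℕ
onTriple R φ x y z = φ (R x y) (R y x) (R x z) (R z x) (R y z) (R z y)

-- sym₆ (onTriple R φ) computes to onTriple R (symmetrize φ)
symmetrize : Bool⁶ ℕ → Bool⁶ ℕ
symmetrize φ b₀₁ b₁₀ b₀₂ b₂₀ b₁₂ b₂₁ =
  φ b₀₁ b₁₀ b₀₂ b₂₀ b₁₂ b₂₁ + (φ b₁₀ b₀₁ b₁₂ b₂₁ b₀₂ b₂₀ + (φ b₀₂ b₂₀ b₀₁ b₁₀ b₂₁ b₁₂ +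
  (φ b₂₁ b₁₂ b₂₀ b₀₂ b₁₀ b₀₁ + (φ b₁₂ b₂₁ b₁₀ b₀₁ b₂₀ b₀₂ + φ b₂₀ b₀₂ b₂₁ b₁₂ b₀₁ b₁₀))))

strictOrder₃ᵇ : Bool⁶ Bool
strictOrder₃ᵇ b₀₁ b₁₀ b₀₂ b₂₀ b₁₂ b₂₁ =
  not (b₀₁ ∧ b₁₀) ∧ not (b₀₂ ∧ b₂₀) ∧ not (b₁₂ ∧ b₂₁) ∧
  transitiveᵇ b₀₁ b₁₂ b₀₂ ∧ transitiveᵇ b₀₂ b₂₁ b₀₁ ∧ transitiveᵇ b₁₀ b₀₂ b₁₂ ∧
  transitiveᵇ b₁₂ b₂₀ b₁₀ ∧ transitiveᵇ b₂₀ b₀₁ b₂₁ ∧ transitiveᵇ b₂₁ b₁₀ b₂₀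

incomparableᵇ : Bool → Bool → Bool
incomparableᵇ uv vu = not uv ∧ not vu

antichainᵇ mutualᵇ pathᵇ overlapᵇ increasingᵇ : Bool⁶ ℕ
antichainᵇ  b₀₁ b₁₀ b₀₂ b₂₀ b₁₂ b₂₁ = χ (incomparableᵇ b₀₁ b₁₀ ∧ incomparableᵇ b₀₂ b₂₀ ∧ incomparableᵇ b₁₂ b₂₁)
mutualᵇ     b₀₁ b₁₀ b₀₂ b₂₀ b₁₂ b₂₁ = χ (not b₀₁) * χ (not b₁₀)
pathᵇ       b₀₁ b₁₀ b₀₂ b₂₀ b₁₂ b₂₁ = χ (not b₀₁) * χ (not b₁₂)
overlapᵇ    b₀₁ b₁₀ b₀₂ b₂₀ b₁₂ b₂₁ = χ (not b₀₁) * (χ (not b₀₂) + (χ (not b₁₂) + (χ (not b₂₀) + χ (not b₂₁))))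
increasingᵇ b₀₁ b₁₀ b₀₂ b₂₀ b₁₂ b₂₁ = χ (b₀₁ ∧ b₁₂)

tripleWeightᴸ tripleWeightᴿ : Bool⁶ ℕ
tripleWeightᴸ b₀₁ b₁₀ b₀₂ b₂₀ b₁₂ b₂₁ =
  antichainᵇ b₀₁ b₁₀ b₀₂ b₂₀ b₁₂ b₂₁ + (2 + (3 * mutualᵇ b₀₁ b₁₀ b₀₂ b₂₀ b₁₂ b₂₁ + 6 * pathᵇ b₀₁ b₁₀ b₀₂ b₂₀ b₁₂ b₂₁))
tripleWeightᴿ b₀₁ b₁₀ b₀₂ b₂₀ b₁₂ b₂₁ = 3 * overlapᵇ b₀₁ b₁₀ b₀₂ b₂₀ b₁₂ b₂₁

tripleCountᴸ tripleCountᴿ : Bool⁶ ℕ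
tripleCountᴸ = symmetrize tripleWeightᴸ
tripleCountᴿ = symmetrize tripleWeightᴿ

tripleCount-identity : Identity⁶ strictOrder₃ᵇ tripleCountᴸ tripleCountᴿ
tripleCount-identity = from-yes (identity⁶? strictOrder₃ᵇ tripleCountᴸ tripleCountᴿ)

-- For a strict total order, distinctness of x, y, z is comparability of each pair.
distinctByComparability : Bool⁶ ℕ
distinctByComparability b₀₁ b₁₀ b₀₂ b₂₀ b₁₂ b₂₁ = χ (distinct₃ᵇ (not (b₀₁ ∨ b₁₀)) (not (b₀₂ ∨ b₂₀)) (not (b₁₂ ∨ b₂₁)))

increasing-identity : Identity⁶ strictOrder₃ᵇ distinctByComparability (symmetrize increasingᵇ)
increasing-identity = from-yes (identity⁶? strictOrder₃ᵇ distinctByComparability (symmetrize increasingᵇ))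

strictOrder₃ᵇ-holds : ∀ {n} (R : Digraph n) →
  (∀ u v → not (R u v ∧ R v u) ≡ true) → (∀ u v w → transitiveᵇ (R u v) (R v w) (R u w) ≡ true) →
  ∀ x y z → strictOrder₃ᵇ (R x y) (R y x) (R x z) (R z x) (R y z) (R z y) ≡ true
strictOrder₃ᵇ-holds R asym transitive x y z =
  ∧-true (asym x y) (∧-true (asym x z) (∧-true (asym y z) (∧-true (transitive x y z) (∧-true (transitive x z y)
    (∧-true (transitive y x z) (∧-true (transitive y z x) (∧-true (transitive z x y) (transitive z y x))))))))

distinctPairs : ℕ → ℕ
distinctPairs n = ∑₂ {n} λ a b → χ (distinct₂ a b)

distinctTriples : ℕ → ℕ
distinctTriples n = ∑₃ {n} λ a b c → χ (distinct₃ a b c)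

module _ {n : ℕ} (R : Digraph n) where

  orderedAntichains : ℕ
  orderedAntichains = ∑₃ λ x y z → χ (distinct₃ x y z) * onTriple R antichainᵇ x y z

  mutualNonArcs-extend : ∑₃ (λ x y z → χ (distinct₃ x y z) * onTriple R mutualᵇ x y z) ≡ (n ∸ 2) * mutualNonArcs R
  mutualNonArcs-extend =
    trans (∑ᴸ-prefix 2 1 (λ ρ → χ (distinct ρ) * onPairs bothNonArcs ρ) (onPairs bothNonArcs) extend)
          (cong (_* mutualNonArcs R) (*-identityʳ (n ∸ 2)))
    where
    bothNonArcs : Fin n → Fin n → ℕ
    bothNonArcs a b = nonArc R a b * nonArc R b a
    extend : ∀ ρ τ → length ρ ≡ 2 → length τ ≡ 1 →
      χ (distinct (ρ ++ τ)) * onPairs bothNonArcs (ρ ++ τ) ≡ χ (distinct (ρ ++ τ)) * onPairs bothNonArcs ρ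
    extend (a ∷ b ∷ []) τ _ _ = refl

module _ {n : ℕ} (R : Digraph n)
         (asym : ∀ u v → not (R u v ∧ R v u) ≡ true)
         (transitive : ∀ u v w → transitiveᵇ (R u v) (R v w) (R u w) ≡ true) where

  nonArcs-double : 2 * nonArcs R ≡ distinctPairs n + mutualNonArcs R
  nonArcs-double = begin
    2 * nonArcs R
      ≡⟨ *-distribˡ-∑₂ 2 (λ a b → χ (distinct₂ a b) * nonArc R a b) ⟩
    ∑₂ (λ a b → 2 * (χ (distinct₂ a b) * nonArc R a b))
      ≡⟨ ∑₂-cong (λ a b → *-left-comm 2 (χ (distinct₂ a b)) (nonArc R a b)) ⟩
    ∑₂ (λ a b → χ (distinct₂ a b) * (2 * nonArc R a b))
      ≡⟨ ∑₂-distinct-cong-sym₂ (λ a b → 2 * nonArc R a b) (λ a b → 1 + nonArc R a b * nonArc R b a)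
           (λ a b _ → pair-count (R a b) (R b a) (asym a b)) ⟩
    ∑₂ (λ a b → χ (distinct₂ a b) * (1 + nonArc R a b * nonArc R b a))
      ≡⟨ ∑₂-cong (λ a b → trans (*-distribˡ-+ (χ (distinct₂ a b)) 1 (nonArc R a b * nonArc R b a))
           (cong (_+ χ (distinct₂ a b) * (nonArc R a b * nonArc R b a)) (*-identityʳ (χ (distinct₂ a b))))) ⟩
    ∑₂ (λ a b → χ (distinct₂ a b) + χ (distinct₂ a b) * (nonArc R a b * nonArc R b a))
      ≡⟨ ∑₂-distrib-+ (λ a b → χ (distinct₂ a b)) (λ a b → χ (distinct₂ a b) * (nonArc R a b * nonArc R b a)) ⟩
    distinctPairs n + mutualNonArcs R ∎
    where
    open ≡-Reasoning
    pair-count : ∀ p q → not (p ∧ q) ≡ true →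
      2 * χ (not p) + 2 * χ (not q) ≡ (1 + χ (not p) * χ (not q)) + (1 + χ (not q) * χ (not p))
    pair-count false false _ = refl
    pair-count false true  _ = refl
    pair-count true  false _ = refl

  triple-relation :
    orderedAntichains R + (2 * distinctTriples n + (3 * ((n ∸ 2) * mutualNonArcs R) + 6 * nonArcPaths R))
      ≡ 3 * overlappingNonArcs R
  triple-relation = begin
    orderedAntichains R + (2 * distinctTriples n + (3 * ((n ∸ 2) * mutualNonArcs R) + 6 * nonArcPaths R))
      ≡⟨ cong (λ i → orderedAntichains R + (2 * distinctTriples n + (3 * i + 6 * nonArcPaths R)))
              (sym (mutualNonArcs-extend R)) ⟩
    orderedAntichains R + (2 * distinctTriples n + (3 * ∑₃ (weighted mutualᵇ) + 6 * nonArcPaths R))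
      ≡⟨ sym split-ᴸ ⟩
    ∑₃ (weighted tripleWeightᴸ)
      ≡⟨ ∑₃-distinct-cong-sym₆ (onTriple R tripleWeightᴸ) (onTriple R tripleWeightᴿ)
           (λ x y z _ → tripleCount-identity (R x y) (R y x) (R x z) (R z x) (R y z) (R z y)
                          (strictOrder₃ᵇ-holds R asym transitive x y z)) ⟩
    ∑₃ (weighted tripleWeightᴿ)
      ≡⟨ trans (∑₃-cong λ x y z → *-left-comm (χ (distinct₃ x y z)) 3 (onTriple R overlapᵇ x y z))
                 (sym (*-distribˡ-∑₃ 3 (weighted overlapᵇ))) ⟩
    3 * overlappingNonArcs R ∎
    where
    open ≡-Reasoning
    open +-*-Solver
    d : Fin n → Fin n → Fin n → ℕ
    d x y z = χ (distinct₃ x y z)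
    weighted : Bool⁶ ℕ → Fin n → Fin n → Fin n → ℕ
    weighted φ x y z = d x y z * onTriple R φ x y z
    split-ᴸ : ∑₃ (weighted tripleWeightᴸ) ≡
      orderedAntichains R + (2 * distinctTriples n + (3 * ∑₃ (weighted mutualᵇ) + 6 * nonArcPaths R))
    split-ᴸ =
      trans (∑₃-cong λ x y z →
                 solve 4 (λ e t i p → e :* (t :+ (con 2 :+ (con 3 :* i :+ con 6 :* p))) :=
                                      e :* t :+ (con 2 :* e :+ (con 3 :* (e :* i) :+ con 6 :* (e :* p))))
                   refl (χ (distinct₃ x y z)) (onTriple R antichainᵇ x y z) (onTriple R mutualᵇ x y z) (onTriple R pathᵇ x y z))
     (trans (∑₃-distrib-+ (weighted antichainᵇ) (λ x y z → 2 * d x y z + (3 * weighted mutualᵇ x y z + 6 * weighted pathᵇ x y z)))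
       (cong (orderedAntichains R +_)
       (trans (∑₃-distrib-+ (λ x y z → 2 * d x y z) (λ x y z → 3 * weighted mutualᵇ x y z + 6 * weighted pathᵇ x y z))
         (cong₂ _+_ (sym (*-distribˡ-∑₃ 2 d))
         (trans (∑₃-distrib-+ (λ x y z → 3 * weighted mutualᵇ x y z) (λ x y z → 6 * weighted pathᵇ x y z))
           (cong₂ _+_ (sym (*-distribˡ-∑₃ 3 (weighted mutualᵇ))) (sym (*-distribˡ-∑₃ 6 (weighted pathᵇ)))))))))

module _ {n : ℕ} where

  finLess : Digraph n
  finLess x y = ⌊ x <? y ⌋

  finLess-asym : ∀ u v → not (finLess u v ∧ finLess v u) ≡ true
  finLess-asym u v with u <? v | v <? u
  ... | yes u<v | yes v<u = ⊥-elim (<-asymᶠ u<v v<u)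
  ... | yes _   | no  _   = refl
  ... | no  _   | _       = refl

  finLess-transitive : ∀ u v w → transitiveᵇ (finLess u v) (finLess v w) (finLess u w) ≡ true
  finLess-transitive u v w with u <? v | v <? w | u <? w
  ... | yes u<v | yes v<w | no u≮w = ⊥-elim (u≮w (<-transᶠ u<v v<w))
  ... | yes _   | yes _   | yes _  = refl
  ... | yes _   | no  _   | _      = refl
  ... | no  _   | _       | _      = refl

  ⌊≟⌋-by-comparability : ∀ (u v : Fin n) → ⌊ u ≟ v ⌋ ≡ not (finLess u v ∨ finLess v u)
  ⌊≟⌋-by-comparability u v with <-cmp u v
  ... | tri< u<v u≢v _   rewrite ⌊⌋-false (u ≟ v) u≢v | ⌊⌋-true (u <? v) u<v = refl
  ... | tri≈ u≮v u≡v v≮u rewrite ⌊⌋-true (u ≟ v) u≡v | ⌊⌋-false (u <? v) u≮v | ⌊⌋-false (v <? u) v≮u = refl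
  ... | tri> u≮v u≢v v<u rewrite ⌊⌋-false (u ≟ v) u≢v | ⌊⌋-false (u <? v) u≮v | ⌊⌋-true (v <? u) v<u = refl

  increasing-orderings : ∀ x y z → sym₆ (λ x y z → χ (finLess x y ∧ finLess y z)) x y z ≡ χ (distinct₃ x y z)
  increasing-orderings x y z = sym (trans
    (distinct₃ᵇ-cong (⌊≟⌋-by-comparability x y) (⌊≟⌋-by-comparability x z) (⌊≟⌋-by-comparability y z))
    (increasing-identity (finLess x y) (finLess y x) (finLess x z) (finLess z x) (finLess y z) (finLess z y)
      (strictOrder₃ᵇ-holds finLess finLess-asym finLess-transitive x y z)))
    where
    distinct₃ᵇ-cong : ∀ {a b c a′ b′ c′} → a ≡ a′ → b ≡ b′ → c ≡ c′ → χ (distinct₃ᵇ a b c) ≡ χ (distinct₃ᵇ a′ b′ c′)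
    distinct₃ᵇ-cong refl refl refl = refl

  ∑₃-increasing : ∀ (W : Fin n → Fin n → Fin n → ℕ) →
    (∀ x y z → W y x z ≡ W x y z) → (∀ x y z → W x z y ≡ W x y z) →
    6 * ∑₃ (λ x y z → χ (finLess x y ∧ finLess y z) * W x y z) ≡ ∑₃ (λ x y z → χ (distinct₃ x y z) * W x y z)
  ∑₃-increasing W W₁₂ W₂₃ = begin
    6 * ∑₃ (λ x y z → increasing x y z * W x y z)
      ≡⟨ cong (6 *_) (∑₃-cong (λ x y z → *-comm (increasing x y z) (W x y z))) ⟩
    6 * ∑₃ (λ x y z → W x y z * increasing x y z)
      ≡⟨ sym (∑₃-sym₆ (λ x y z → W x y z * increasing x y z)) ⟩
    ∑₃ (sym₆ (λ x y z → W x y z * increasing x y z))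
      ≡⟨ ∑₃-cong (sym₆-symmetric-factor W W₁₂ W₂₃ increasing) ⟩
    ∑₃ (λ x y z → W x y z * sym₆ increasing x y z)
      ≡⟨ ∑₃-cong (λ x y z → trans (cong (W x y z *_) (increasing-orderings x y z)) (*-comm (W x y z) _)) ⟩
    ∑₃ (λ x y z → χ (distinct₃ x y z) * W x y z) ∎
    where
    open ≡-Reasoning
    increasing : Fin n → Fin n → Fin n → ℕ
    increasing x y z = χ (finLess x y ∧ finLess y z)

-- Incomparable triples of a finite poset

module _ (P : FinPoset) where

  private
    n : ℕ
    n = size P
    lt : Digraph n
    lt = ltᵇ P
    open IsDecPartialOrder (isDPO P) using (antisym) renaming (trans to ≤-transᴾ)

  lt⇒≤×≢ : ∀ {u v} → lt u v ≡ true → _≤P_ P u v × u ≢ v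
  lt⇒≤×≢ lt≡true = toWitness (Equivalence.from T-≡ lt≡true)

  ≤×≢⇒lt : ∀ {u v} → _≤P_ P u v → u ≢ v → lt u v ≡ true
  ≤×≢⇒lt u≤v u≢v = Equivalence.to T-≡ (fromWitness (u≤v , u≢v))

  lt-asym : ∀ u v → not (lt u v ∧ lt v u) ≡ true
  lt-asym u v with lt u v in uv | lt v u in vu
  ... | true  | true  = ⊥-elim (proj₂ (lt⇒≤×≢ uv) (antisym (proj₁ (lt⇒≤×≢ uv)) (proj₁ (lt⇒≤×≢ vu))))
  ... | true  | false = refl
  ... | false | _     = refl

  lt-transitive : ∀ u v w → transitiveᵇ (lt u v) (lt v w) (lt u w) ≡ true
  lt-transitive u v w with lt u v in uv | lt v w in vw | lt u w in uw
  ... | true  | true  | false = ⊥-elim (true≢false (trans (sym (≤×≢⇒lt (≤-transᴾ u≤v v≤w) u≢w)) uw))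
    where
    u≤v : _≤P_ P u v
    u≤v = proj₁ (lt⇒≤×≢ uv)
    v≤w : _≤P_ P v w
    v≤w = proj₁ (lt⇒≤×≢ vw)
    u≢w : u ≢ w
    u≢w refl = proj₂ (lt⇒≤×≢ uv) (antisym u≤v v≤w)
    true≢false : true ≢ false
    true≢false ()
  ... | true  | true  | true  = refl
  ... | true  | false | _     = refl
  ... | false | _     | _     = refl

  incompᵇ≡incomparableᵇ : ∀ u v → u ≢ v → incompᵇ P u v ≡ incomparableᵇ (lt u v) (lt v u)
  incompᵇ≡incomparableᵇ u v u≢v with u ≟ v | v ≟ u
  ... | yes u≡v | _       = ⊥-elim (u≢v u≡v)
  ... | no  _   | yes v≡u = ⊥-elim (u≢v (sym v≡u))
  ... | no  _   | no  _   with _≤P?_ P u v | _≤P?_ P v u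
  ...   | yes _ | yes _ = refl
  ...   | yes _ | no  _ = refl
  ...   | no  _ | yes _ = refl
  ...   | no  _ | no  _ = refl

  incompTriples-∑₃ : incompTriples P ≡ ∑₃ (λ x y z → χ (finLess x y ∧ finLess y z) * onTriple lt antichainᵇ x y z)
  incompTriples-∑₃ = begin
    incompTriples P
      ≡⟨ sumˡ-concatMap (λ a → concatMap (λ b → map (term a b) (allFin n)) (allFin n)) (allFin n) ⟩
    sumˡ (map (λ a → sumˡ (concatMap (λ b → map (term a b) (allFin n)) (allFin n))) (allFin n))
      ≡⟨ sumˡ-allFin (λ a → sumˡ (concatMap (λ b → map (term a b) (allFin n)) (allFin n))) ⟩
    ∑[ a < n ] sumˡ (concatMap (λ b → map (term a b) (allFin n)) (allFin n))
      ≡⟨ sum-cong-≗ (λ a → trans (sumˡ-concatMap (λ b → map (term a b) (allFin n)) (allFin n))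
           (trans (sumˡ-allFin (λ b → sumˡ (map (term a b) (allFin n)))) (sum-cong-≗ (λ b → sumˡ-allFin (term a b))))) ⟩
    ∑[ a < n ] ∑[ b < n ] ∑[ c < n ] term a b c
      ≡⟨ trans (sum-cong-≗ (λ a → ∑-comm (term a)))
           (trans (∑-comm (λ a c → ∑[ b < n ] term a b c)) (sum-cong-≗ (λ c → ∑-comm (λ a b → term a b c)))) ⟩
    ∑₃ term
      ≡⟨ ∑₃-cong antichain-term ⟩
    ∑₃ (λ x y z → χ (finLess x y ∧ finLess y z) * onTriple lt antichainᵇ x y z) ∎
    where
    open ≡-Reasoning
    term : Fin n → Fin n → Fin n → ℕ
    term a b c = if ⌊ a <? b ⌋ ∧ ⌊ b <? c ⌋ ∧ incompᵇ P a b ∧ incompᵇ P a c ∧ incompᵇ P b c then 1 else 0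
    antichain-term : ∀ x y z → term x y z ≡ χ (finLess x y ∧ finLess y z) * onTriple lt antichainᵇ x y z
    antichain-term x y z with x <? y | y <? z
    ... | no  _   | _       = refl
    ... | yes _   | no  _   = refl
    ... | yes x<y | yes y<z
      rewrite incompᵇ≡incomparableᵇ x y (<⇒≢ x<y) | incompᵇ≡incomparableᵇ x z (<⇒≢ (<-transᶠ x<y y<z))
            | incompᵇ≡incomparableᵇ y z (<⇒≢ y<z)
      = sym (+-identityʳ _)

  six-incompTriples : 6 * incompTriples P ≡ orderedAntichains (D P)
  six-incompTriples = trans (cong (6 *_) incompTriples-∑₃) (∑₃-increasing (onTriple lt antichainᵇ) swap₁₂ swap₂₃)
    where
    swap₁₂ : ∀ x y z → onTriple lt antichainᵇ y x z ≡ onTriple lt antichainᵇ x y z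
    swap₁₂ x y z = from-yes (identity⁶? (λ _ _ _ _ _ _ → true)
      (λ b₀₁ b₁₀ b₀₂ b₂₀ b₁₂ b₂₁ → antichainᵇ b₁₀ b₀₁ b₁₂ b₂₁ b₀₂ b₂₀) antichainᵇ)
      (lt x y) (lt y x) (lt x z) (lt z x) (lt y z) (lt z y) refl
    swap₂₃ : ∀ x y z → onTriple lt antichainᵇ x z y ≡ onTriple lt antichainᵇ x y z
    swap₂₃ x y z = from-yes (identity⁶? (λ _ _ _ _ _ _ → true)
      (λ b₀₁ b₁₀ b₀₂ b₂₀ b₁₂ b₂₁ → antichainᵇ b₀₂ b₂₀ b₀₁ b₁₀ b₂₁ b₁₂) antichainᵇ)
      (lt x y) (lt y x) (lt x z) (lt z x) (lt y z) (lt z y) refl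

Invariants : Set
Invariants = ℕ × ℕ × ℕ × ℕ

invariants : ∀ {n} → Digraph n → Invariants
invariants {n} X = n , nonArcs X , nonArcPaths X , nonArcPairs X

U-determines-invariants : ∀ {n n′} (X : Digraph n) (Y : Digraph n′) → U X ≈S U Y → invariants X ≡ invariants Y
U-determines-invariants X Y U≈ with U-determines-size X Y U≈
... | refl = cong₂ _,_ refl (cong₂ _,_ (U-determines-nonArcs X Y U≈)
               (cong₂ _,_ (U-determines-nonArcPaths X Y U≈) (U-determines-nonArcPairs X Y U≈)))

correction : ℕ → ℕ → ℕ → ℕ → ℕ → ℕ
correction n a₁ a₂ a₃ m = 2 * distinctTriples n + (3 * ((n ∸ 2) * m) + (6 * a₂ + 3 * (a₃ + (a₁ + m))))

-- For a strict order 2 * a₁ ∸ distinctPairs n is mutualNonArcs (nonArcs-double), and both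
-- truncated subtractions are exact.
incompTriplesFormula : Invariants → ℕ
incompTriplesFormula (n , a₁ , a₂ , a₃) = 3 * (a₁ * a₁) ∸ correction n a₁ a₂ a₃ (2 * a₁ ∸ distinctPairs n)

module _ (P : FinPoset) where

  private
    n  = size P
    A₁ A₂ A₃ M : ℕ
    A₁ = nonArcs (D P)
    A₂ = nonArcPaths (D P)
    A₃ = nonArcPairs (D P)
    M  = mutualNonArcs (D P)

  six-incompTriples+correction : 6 * incompTriples P + correction n A₁ A₂ A₃ M ≡ 3 * (A₁ * A₁)
  six-incompTriples+correction = begin
    6 * incompTriples P + (2 * distinctTriples n + (3 * ((n ∸ 2) * M) + (6 * A₂ + 3 * (A₃ + (A₁ + M)))))
      ≡⟨ cong (_+ correction n A₁ A₂ A₃ M) (six-incompTriples P) ⟩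
    orderedAntichains (D P) + (2 * distinctTriples n + (3 * ((n ∸ 2) * M) + (6 * A₂ + 3 * (A₃ + (A₁ + M)))))
      ≡⟨ solve 5 (λ t d i p r → t :+ (d :+ (i :+ (p :+ r))) := (t :+ (d :+ (i :+ p))) :+ r)
           refl (orderedAntichains (D P)) (2 * distinctTriples n) (3 * ((n ∸ 2) * M)) (6 * A₂) (3 * (A₃ + (A₁ + M))) ⟩
    (orderedAntichains (D P) + (2 * distinctTriples n + (3 * ((n ∸ 2) * M) + 6 * A₂))) + 3 * (A₃ + (A₁ + M))
      ≡⟨ cong (_+ 3 * (A₃ + (A₁ + M))) (triple-relation (D P) (lt-asym P) (lt-transitive P)) ⟩
    3 * overlappingNonArcs (D P) + 3 * (A₃ + (A₁ + M))
      ≡⟨ solve 4 (λ l a₃ a₁ m → con 3 :* l :+ con 3 :* (a₃ :+ (a₁ :+ m)) := con 3 :* (a₃ :+ (l :+ (a₁ :+ m))))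
           refl (overlappingNonArcs (D P)) A₃ A₁ M ⟩
    3 * (A₃ + (overlappingNonArcs (D P) + (A₁ + M)))
      ≡⟨ cong (3 *_) (sym (nonArcs-square (D P))) ⟩
    3 * (A₁ * A₁) ∎
    where
    open ≡-Reasoning
    open +-*-Solver

  six-incompTriples≡formula : 6 * incompTriples P ≡ incompTriplesFormula (invariants (D P))
  six-incompTriples≡formula = begin
    6 * incompTriples P
      ≡⟨ sym (m+n∸n≡m _ (correction n A₁ A₂ A₃ M)) ⟩
    6 * incompTriples P + correction n A₁ A₂ A₃ M ∸ correction n A₁ A₂ A₃ M
      ≡⟨ cong (_∸ correction n A₁ A₂ A₃ M) six-incompTriples+correction ⟩
    3 * (A₁ * A₁) ∸ correction n A₁ A₂ A₃ M
      ≡⟨ cong (λ m → 3 * (A₁ * A₁) ∸ correction n A₁ A₂ A₃ m) M≡ ⟩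
    incompTriplesFormula (invariants (D P)) ∎
    where
    open ≡-Reasoning
    M≡ : M ≡ 2 * A₁ ∸ distinctPairs n
    M≡ = sym (trans (cong (_∸ distinctPairs n) (nonArcs-double (D P) (lt-asym P) (lt-transitive P)))
                      (m+n∸m≡n (distinctPairs n) M))

mainTheorem6 : (P Q : FinPoset) → U-poset P ≈S U-poset Q →
    incompTriples P ≡ incompTriples Q
mainTheorem6 P Q U≈ = *-cancelˡ-≡ _ _ 6 (begin
  6 * incompTriples P                      ≡⟨ six-incompTriples≡formula P ⟩
  incompTriplesFormula (invariants (D P))  ≡⟨ cong incompTriplesFormula (U-determines-invariants (D P) (D Q) U≈) ⟩
  incompTriplesFormula (invariants (D Q))  ≡⟨ sym (six-incompTriples≡formula Q) ⟩
  6 * incompTriples Q                      ∎)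
  where open ≡-Reasoning
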